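{- Let $n\ge1$ and $0\le k\le n-1$. The following sets are equinumerous: (1) the set of recurrent configurations $c$ on the fan graph $F_n$ with $\mathrm{level}(c)=k$; (2) the set of subgraphs $(V,E)$ of the path graph $P_n$ with $n\in V$ and $|E|=k$; (3) the set $\mathrm{Kimb}(n-k,k)$ of Kimberling paths ending at $(n-k,k)$. In particular, if $T_{F_n}(x,y)$ is the Tutte polynomial of $F_n$, then $T_{F_n}(1,x)=\sum_{k=0}^{n-1}|\mathrm{Kimb}(n-k,k)|\,x^k$.
   Context: The path graph $P_n$ has vertex set $[n]$ and edges $\{i,i+1\}$, $i\in[n-1]$. The fan graph $F_n$ has vertex set $\{0,\dots,n\}$, the edges of $P_n$, and edges $\{0,i\}$ for all $i\in[n]$; $0$ is the sink. A subgraph of $P_n$ is a pair $(V,E)$ with $V\subseteq[n]$ non-empty and $E$ a set of edges of $P_n$ with both endpoints in $V$. Abelian sandpile model: a configuration on $F_n$ is $c\in\mathbb{Z}_{\ge0}^n$, stable if $c_i<\deg(i)$ for all $i\in[n]$. Toppling an unstable vertex $i$ removes $\deg(i)$ grains from $i$ and gives one to each neighbour (grains sent to $0$ are lost); repeated toppling gives a unique stabilisation. With a distribution $\mu$ on $[n]$, all $\mu_i>0$, the Markov chain on stable configurations adds a grain at $i$ with probability $\mu_i$ and stabilises; recurrent configurations are the recurrent states of this chain. The level of $c$ is $\sum_ic_i+\deg(0)-|E(F_n)|=\sum_ic_i-n+1$. A Kimberling path is a lattice path starting at $(0,0)$ whose steps are vectors in $\mathbb{N}\times\mathbb{Z}_{\ge0}$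 (positive horizontal displacement, non-negative vertical displacement, arbitrary length); $\mathrm{Kimb}(i,j)$ is the set of Kimberling paths ending at $(i,j)$. -}

module Defs where

open import Data.Bool using (Bool; true; false; _∧_; _∨_; not; if_then_else_)
open import Data.Nat as ℕ using (ℕ; zero; suc; _+_; _∸_; _≤_; _<_; _≡ᵇ_; _<ᵇ_)
open import Data.Integer as ℤ using (ℤ; +_)
open import Data.Fin using (Fin; toℕ)
open import Data.Fin.Subset using (Subset; _∈_; Nonempty; ∣_∣)
open import Data.Vec as Vec using (Vec; lookup; _[_]%=_; tabulate)
open import Data.List as List using (List; []; _∷_; _++_; map; upTo; length; foldr; filter)
open import Data.Bool.ListAction using (any; all)
open import Data.Nat.ListAction using (sum)
open import Data.List.Relation.Unary.All using (All)
open import Data.List.Relation.Unary.Unique.Propositional using (Unique)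
open import Data.List.Membership.Propositional using () renaming (_∈_ to _∈L_)
open import Data.Product using (Σ; _×_; _,_; proj₁; proj₂)
open import Function.Bundles using (_⇔_)
open import Relation.Binary.PropositionalEquality using (_≡_)
open import Relation.Binary.Construct.Closure.ReflexiveTransitive using (Star)

HasCard : {A : Set} → (A → Set) → ℕ → Set
HasCard {A} P m =
  Σ (List A) λ xs → Unique xs × (∀ x → (x ∈L xs) ⇔ P x) × length xs ≡ m

-- Finite (multi)graphs with vertex set {0,…,N-1} given by an edge list.

record Graph : Set where
  field
    N     : ℕ
    edges : List (ℕ × ℕ)
open Graph public

-- number of edges joining u and v (u ≠ v intended)
mult : List (ℕ × ℕ) → ℕ → ℕ → ℕ
mult es u v = length (filter (λ e → ((proj₁ e ℕ.≟ u) Relation.Nullary.×-dec (proj₂ e ℕ.≟ v))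
                                   Relation.Nullary.⊎-dec ((proj₁ e ℕ.≟ v) Relation.Nullary.×-dec (proj₂ e ℕ.≟ u))) es)
  where import Relation.Nullary

degree : List (ℕ × ℕ) → ℕ → ℕ
degree es v = length (filter (λ e → (proj₁ e ℕ.≟ v) Relation.Nullary.⊎-dec (proj₂ e ℕ.≟ v)) es)
  where import Relation.Nullary

-- the fan graph F_n: vertices 0,…,n ; path edges {i,i+1} (1 ≤ i ≤ n-1)
-- and spokes {0,i} (1 ≤ i ≤ n)
fanEdges : ℕ → List (ℕ × ℕ)
fanEdges n = map (λ i → (suc i , suc (suc i))) (upTo (n ∸ 1))
          ++ map (λ i → (0 , suc i)) (upTo n)

Fan : ℕ → Graph
Fan n = record { N = suc n ; edges = fanEdges n }

subsets : {A : Set} → List A → List (List A)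
subsets []       = [] ∷ []
subsets (e ∷ es) = map (e ∷_) (subsets es) ++ subsets es

_==_ : ℕ → ℕ → Bool
_==_ = _≡ᵇ_

spread : List (ℕ × ℕ) → (ℕ → Bool) → (ℕ → Bool)
spread A R v = R v ∨ any (λ e → (R (proj₁ e) ∧ (proj₂ e == v)) ∨ (R (proj₂ e) ∧ (proj₁ e == v))) A

iter : ℕ → ((ℕ → Bool) → (ℕ → Bool)) → (ℕ → Bool) → (ℕ → Bool)
iter zero    f R = R
iter (suc t) f R = f (iter t f R)

-- connected N A u v : v is reachable from u in (V, A), |V| = N
-- (paths have length < N, so N propagation steps suffice)
connected : ℕ → List (ℕ × ℕ) → ℕ → ℕ → Bool
connected N A u v = iter N (spread A) (λ w → u == w) v

-- number of connected components: vertices that are the least vertex of their component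
components : ℕ → List (ℕ × ℕ) → ℕ
components N A = length (filter (λ v → Data.Bool.T? (all (λ u → not (connected N A u v)) (upTo v))) (upTo N))
  where import Data.Bool

rank : ℕ → List (ℕ × ℕ) → ℕ
rank N A = N ∸ components N A

sumℤ : List ℤ → ℤ
sumℤ = foldr ℤ._+_ (+ 0)

tutte : Graph → ℤ → ℤ → ℤ
tutte G x y = sumℤ (map term (subsets (edges G)))
  where
    term : List (ℕ × ℕ) → ℤ
    term A = ((x ℤ.- + 1) ℤ.^ (rank (N G) (edges G) ∸ rank (N G) A))
        ℤ.* ((y ℤ.- + 1) ℤ.^ (length A ∸ rank (N G) A))

-- Abelian sandpile model on F_n (sink 0).  A configuration is a vector
-- c ∈ ℕ^n ; the entry at index f : Fin n is the number of grains on
-- vertex suc (toℕ f) ∈ [n].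

Config : ℕ → Set
Config n = Vec ℕ n

label : {n : ℕ} → Fin n → ℕ
label f = suc (toℕ f)

deg : (n : ℕ) → ℕ → ℕ
deg n v = degree (fanEdges n) v

Stable : (n : ℕ) → Config n → Set
Stable n c = ∀ f → lookup c f < deg n (label f)

topple : (n : ℕ) → Config n → Fin n → Config n
topple n c f = tabulate λ g →
  if toℕ g == toℕ f then lookup c g ∸ deg n (label f)
  else lookup c g + mult (fanEdges n) (label f) (label g)

data ToppleStep (n : ℕ) : Config n → Config n → Set where
  step : (c : Config n) (f : Fin n) → deg n (label f) ≤ lookup c f →
         ToppleStep n c (topple n c f)

Stabilises : (n : ℕ) → Config n → Config n → Set
Stabilises n c d = Star (ToppleStep n) c d × Stable n d

-- one-step transitions of the Markov chain with positive probability
-- (add a grain at some vertex, then stabilise); since all μ_i > 0,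
-- the set of possible transitions does not depend on μ.
data Transition (n : ℕ) : Config n → Config n → Set where
  trans : (c d : Config n) (f : Fin n) → Stable n c →
          Stabilises n (c [ f ]%= suc) d → Transition n c d

Reach : (n : ℕ) → Config n → Config n → Set
Reach n = Star (Transition n)

Recurrent : (n : ℕ) → Config n → Set
Recurrent n c = Stable n c × (∀ d → Reach n c d → Reach n d c)

level : (n : ℕ) → Config n → ℤ
level n c = (+ Vec.sum c ℤ.+ + deg n 0) ℤ.- + length (fanEdges n)

RecurrentOfLevel : (n k : ℕ) → Config n → Set
RecurrentOfLevel n k c = Recurrent n c × level n c ≡ + k

-- Subgraphs (V, E) of P_n.  V : Subset n, index f ↦ vertex suc (toℕ f);
-- E : Subset (n ∸ 1), index e ↦ edge {suc (toℕ e), suc (suc (toℕ e))}.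

InV : {n : ℕ} → Subset n → ℕ → Set
InV {n} V j = Σ (Fin n) λ f → label f ≡ j × f ∈ V

PathSubgraph : ℕ → Set
PathSubgraph n = Subset n × Subset (n ∸ 1)

IsSubgraphWithLastVertex : (n k : ℕ) → PathSubgraph n → Set
IsSubgraphWithLastVertex n k (V , E) =
  Nonempty V ×
  (∀ e → e ∈ E → InV V (suc (toℕ e)) × InV V (suc (suc (toℕ e)))) ×
  InV V n ×
  ∣ E ∣ ≡ k

-- Kimberling paths: sequences of steps (a , b) with a ≥ 1, b ≥ 0,
-- starting at (0,0) and ending at (i , j).

KimbPath : ℕ → ℕ → List (ℕ × ℕ) → Set
KimbPath i j steps =
  All (λ s → 1 ≤ proj₁ s) steps ×
  sum (map proj₁ steps) ≡ i ×
  sum (map proj₂ steps) ≡ j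

polySum : ℕ → (ℕ → ℕ) → ℤ → ℤ
polySum n a x = sumℤ (map (λ k → + a k ℤ.* (x ℤ.^ k)) (upTo n))

-- All four statements come down to one pair of recurrences in n, solved by kimb n k (the
-- Kimberling paths of size n and height k) and kimb₀ n k (those starting horizontally).
-- Kimberling paths, and subgraphs of P_n containing n, decompose by their first step or vertex.
-- A stable configuration on F_n is recurrent iff no interval of the path is forbidden (Dhar's
-- burning criterion; conversely every such configuration is reached from the maximal stable one
-- by explicit avalanches).  This is a regular property of the word c_1 … c_n; a three-state
-- automaton reading it, and tracking the level, yields the recurrences.  Finally T_{F_n}(1, y) is
-- the sum of (y - 1)^nullity over connected spanning edge sets; scanning the fan vertex by vertex
-- gives a 2 × 2 transfer matrix whose entries are the generating polynomials of kimb and kimb₀.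
module Submission where

open import Defs hiding (trans)
open import Data.Bool using (Bool; true; false; _∧_; _∨_; not; T; T?; if_then_else_)
open import Data.Bool.Properties using (T-≡; T-∧; T-∨)
open import Data.Nat using (ℕ; zero; suc; _+_; _∸_; _≤_; _<_; z≤n; s≤s; z<s; s≤s⁻¹; _≡ᵇ_; _<ᵇ_; _≟_; _≤?_; _<?_)
open import Data.Nat.Properties
open import Data.Fin using (Fin; toℕ; fromℕ<) renaming (zero to fzero; suc to fsuc)
open import Data.Fin.Properties using (toℕ<n; toℕ-fromℕ<)
open import Data.Vec as Vec using (Vec; []; _∷_; lookup; tabulate; _[_]%=_; replicate)
open import Data.Vec.Properties using (lookup∘tabulate; ∷-injectiveʳ)
open import Data.List using (List; []; _∷_; _++_; map; length; filter; applyUpTo; upTo)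
open import Data.List.Properties using (length-++; length-map; length-upTo; filter-accept; filter-reject; filter-++; map-upTo; map-applyUpTo; upTo-∷ʳ)
open import Data.List.Membership.Propositional using (_∈_)
open import Data.List.Membership.Propositional.Properties using (∈-map⁺; ∈-map⁻; ∈-++⁺ˡ; ∈-++⁺ʳ; ∈-++⁻)
open import Data.List.Relation.Unary.Any using (here; there)
open import Data.List.Relation.Unary.All using (All; []; _∷_)
open import Data.List.Relation.Unary.Unique.Propositional using (Unique)
open import Data.Product using (Σ; ∃; _×_; _,_; proj₁; proj₂)
open import Data.Sum as Sum using (_⊎_; inj₁; inj₂; [_,_]′)
open import Data.Empty using (⊥; ⊥-elim)
open import Data.Unit using (⊤; tt)
open import Function using (_∘_; id)
open import Function.Bundles using (_⇔_; mk⇔; Equivalence)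
open import Relation.Nullary using (¬_; yes; no)
open import Relation.Unary using (Decidable)
open import Relation.Binary using (tri<; tri≈; tri>)
open import Relation.Binary.PropositionalEquality
open import Relation.Binary.Construct.Closure.ReflexiveTransitive using (Star; ε; _◅_; _◅◅_)
open import Data.Nat.Solver using (module +-*-Solver)

module Enumeration where

  open import Data.List.Relation.Unary.Unique.Propositional.Properties using (++⁺)
  import Data.List.Relation.Unary.All as All
  import Data.List.Relation.Unary.All.Properties as AllP
  import Data.List.Relation.Unary.AllPairs as AllPairs

  private
    variable
      A B : Set
      P Q R S : A → Set
      xs ys zs : List A

  Enumerates : (A → Set) → List A → Set
  Enumerates P xs = Unique xs × (∀ x → x ∈ xs ⇔ P x)

  hasCard : Enumerates P xs → HasCard P (length xs)
  hasCard {xs = xs} (unique , members) = xs , unique , members , refl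

  enumerates-[] : (∀ x → ¬ P x) → Enumerates P []
  enumerates-[] ¬P = AllPairs.[] , λ x → mk⇔ (λ ()) (⊥-elim ∘ ¬P x)

  enumerates-singleton : (a : A) → (∀ x → P x → x ≡ a) → P a → Enumerates P (a ∷ [])
  enumerates-singleton a only Pa = All.[] AllPairs.∷ AllPairs.[] , λ x → mk⇔ (λ { (here refl) → Pa }) (here ∘ only x)

  enumerates-⇔ : (∀ x → P x → Q x) → (∀ x → Q x → P x) → Enumerates P xs → Enumerates Q xs
  enumerates-⇔ P⇒Q Q⇒P (unique , members) =
    unique , λ x → mk⇔ (P⇒Q x ∘ Equivalence.to (members x)) (Equivalence.from (members x) ∘ Q⇒P x)

  enumerates-++ : Enumerates P xs → Enumerates Q ys → (∀ x → P x → Q x → ⊥) →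
                  Enumerates (λ x → P x ⊎ Q x) (xs ++ ys)
  enumerates-++ {xs = xs} (uP , mP) (uQ , mQ) disjoint =
    ++⁺ uP uQ (λ (i , j) → disjoint _ (Equivalence.to (mP _) i) (Equivalence.to (mQ _) j)) ,
    λ x → mk⇔ (Sum.map (Equivalence.to (mP x)) (Equivalence.to (mQ x)) ∘ ∈-++⁻ xs)
              ([ ∈-++⁺ˡ ∘ Equivalence.from (mP x) , ∈-++⁺ʳ xs ∘ Equivalence.from (mQ x) ]′)

  Image : (A → B) → (A → Set) → B → Set
  Image {A} f P b = Σ A λ a → P a × b ≡ f a

  unique-map : (f : A → B) → (∀ {x y} → x ∈ xs → y ∈ xs → f x ≡ f y → x ≡ y) →
               Unique xs → Unique (map f xs)
  unique-map {xs = []} f inj AllPairs.[] = AllPairs.[]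
  unique-map {xs = x ∷ xs} f inj (x∉xs AllPairs.∷ unique) =
    AllP.map⁺ (All.tabulate λ y∈xs fx≡fy → All.lookup x∉xs y∈xs (inj (here refl) (there y∈xs) fx≡fy))
      AllPairs.∷ unique-map f (λ i j → inj (there i) (there j)) unique

  enumerates-map : (f : A → B) → (∀ {x y} → P x → P y → f x ≡ f y → x ≡ y) →
                   Enumerates P xs → Enumerates (Image f P) (map f xs)
  enumerates-map {xs = xs} f inj (unique , members) =
    unique-map f (λ i j → inj (Equivalence.to (members _) i) (Equivalence.to (members _) j)) unique ,
    λ b → mk⇔ (λ b∈ → image (∈-map⁻ f b∈))
              (λ (a , Pa , b≡fa) → subst (_∈ map f xs) (sym b≡fa) (∈-map⁺ f (Equivalence.from (members a) Pa)))
    where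
    image : ∀ {b} → Σ _ (λ a → a ∈ xs × b ≡ f a) → Image f _ b
    image (a , a∈ , b≡fa) = a , Equivalence.to (members a) a∈ , b≡fa

  enumerates-⊎ : Enumerates P xs → Enumerates Q ys → (∀ x → P x → Q x → ⊥) →
                 (∀ x → S x → P x ⊎ Q x) → (∀ x → P x → S x) → (∀ x → Q x → S x) →
                 Enumerates S (xs ++ ys)
  enumerates-⊎ eP eQ disjoint split P⇒S Q⇒S =
    enumerates-⇔ (λ x → [ P⇒S x , Q⇒S x ]′) split (enumerates-++ eP eQ disjoint)

  enumerates-⊎₃ : Enumerates P xs → Enumerates Q ys → Enumerates R zs →
                  (∀ x → P x → Q x → ⊥) → (∀ x → P x → R x → ⊥) → (∀ x → Q x → R x → ⊥) →
                  (∀ x → S x → P x ⊎ (Q x ⊎ R x)) →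
                  (∀ x → P x → S x) → (∀ x → Q x → S x) → (∀ x → R x → S x) →
                  Enumerates S (xs ++ (ys ++ zs))
  enumerates-⊎₃ eP eQ eR dPQ dPR dQR split P⇒S Q⇒S R⇒S =
    enumerates-⇔ (λ x → [ P⇒S x , [ Q⇒S x , R⇒S x ]′ ]′) split
      (enumerates-++ eP (enumerates-++ eQ eR dQR) λ x p → [ dPQ x p , dPR x p ]′)

  length-map-++ : ∀ {A B : Set} (f : A → B) xs (ys : List B) → length (map f xs ++ ys) ≡ length xs + length ys
  length-map-++ f xs ys = trans (length-++ (map f xs)) (cong (_+ length ys) (length-map f xs))

  length-map-++-map : ∀ {A B : Set} (f g : A → B) xs ys → length (map f xs ++ map g ys) ≡ length xs + length ys
  length-map-++-map f g xs ys = trans (length-map-++ f xs (map g ys)) (cong (length xs +_) (length-map g ys))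

  Shift : (ℕ → A → Set) → ℕ → A → Set
  Shift P zero    _ = ⊥
  Shift P (suc k) x = P k x

  shift : (ℕ → List A) → ℕ → List A
  shift f zero    = []
  shift f (suc k) = f k

  enumerates-shift : {P : ℕ → A → Set} {f : ℕ → List A} →
                     (∀ k → Enumerates (P k) (f k)) → ∀ k → Enumerates (Shift P k) (shift f k)
  enumerates-shift e zero    = enumerates-[] λ _ ()
  enumerates-shift e (suc k) = e k

-- kimb n k counts the Kimberling paths with (horizontal + vertical) length n and height k;
-- kimb₀ n k those whose first step is horizontal, together with the empty path for n = 0.
module KimberlingNumbers where

  mutual
    kimb : ℕ → ℕ → ℕ
    kimb zero    k = 0
    kimb (suc n) k = kimb n k + (kimbShift n k + kimb₀ n k)

    kimbShift : ℕ → ℕ → ℕ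
    kimbShift n zero    = 0
    kimbShift n (suc k) = kimb n k

    kimb₀ : ℕ → ℕ → ℕ
    kimb₀ zero    zero    = 1
    kimb₀ zero    (suc k) = 0
    kimb₀ (suc n) k       = kimb n k + kimb₀ n k

  open Enumeration using (shift)

  length-shift : ∀ {A : Set} (f : ℕ → List A) n → (∀ k → length (f k) ≡ kimb n k) → ∀ k → length (shift f k) ≡ kimbShift n k
  length-shift f n lengths zero    = refl
  length-shift f n lengths (suc k) = lengths k

module CountFilter {A : Set} {P : A → Set} (P? : Decidable P) where

  count-none : ∀ (h : ℕ → A) m → (∀ i → i < m → ¬ P (h i)) →
               length (filter P? (applyUpTo h m)) ≡ 0
  count-none h zero    _  = refl
  count-none h (suc m) ¬P rewrite filter-reject P? {h 0} {applyUpTo (h ∘ suc) m} (¬P 0 z<s) =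
    count-none (h ∘ suc) m λ i i<m → ¬P (suc i) (s≤s i<m)

  count-all : ∀ (h : ℕ → A) m → (∀ i → i < m → P (h i)) →
              length (filter P? (applyUpTo h m)) ≡ m
  count-all h zero    _  = refl
  count-all h (suc m) Ph rewrite filter-accept P? {h 0} {applyUpTo (h ∘ suc) m} (Ph 0 z<s) =
    cong suc (count-all (h ∘ suc) m λ i i<m → Ph (suc i) (s≤s i<m))

  count-one : ∀ (h : ℕ → A) m t → t < m → P (h t) → (∀ i → i < m → P (h i) → i ≡ t) →
              length (filter P? (applyUpTo h m)) ≡ 1
  count-one h (suc m) zero _ Pt only rewrite filter-accept P? {h 0} {applyUpTo (h ∘ suc) m} Pt =
    cong suc (count-none (h ∘ suc) m λ i i<m Pi → 1+n≢0 (only (suc i) (s≤s i<m) Pi))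
  count-one h (suc m) (suc t) (s≤s t<m) Pt only
    rewrite filter-reject P? {h 0} {applyUpTo (h ∘ suc) m} (λ P0 → 0≢1+n (only 0 z<s P0)) =
    count-one (h ∘ suc) m t t<m Pt λ i i<m Pi → suc-injective (only (suc i) (s≤s i<m) Pi)

  private
    0≢either : ∀ {t} → ¬ (0 ≡ suc t ⊎ 0 ≡ suc (suc t))
    0≢either (inj₁ ())
    0≢either (inj₂ ())

  count-two : ∀ (h : ℕ → A) m t → suc t < m → P (h t) → P (h (suc t)) →
              (∀ i → i < m → P (h i) → i ≡ t ⊎ i ≡ suc t) →
              length (filter P? (applyUpTo h m)) ≡ 2
  count-two h (suc m) zero (s≤s t<m) Pt Pt+1 only rewrite filter-accept P? {h 0} {applyUpTo (h ∘ suc) m} Pt =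
    cong suc (count-one (h ∘ suc) m 0 t<m Pt+1 λ i i<m Pi → one (only (suc i) (s≤s i<m) Pi))
    where
    one : ∀ {i} → suc i ≡ 0 ⊎ suc i ≡ 1 → i ≡ 0
    one (inj₂ refl) = refl
  count-two h (suc m) (suc t) (s≤s t<m) Pt Pt+1 only
    rewrite filter-reject P? {h 0} {applyUpTo (h ∘ suc) m} (λ P0 → 0≢either (only 0 z<s P0)) =
    count-two (h ∘ suc) m t t<m Pt Pt+1 λ i i<m Pi → pred (only (suc i) (s≤s i<m) Pi)
    where
    pred : ∀ {i} → suc i ≡ suc t ⊎ suc i ≡ suc (suc t) → i ≡ t ⊎ i ≡ suc t
    pred = Sum.map suc-injective suc-injective

module Fan where

  open import Relation.Nullary using (_×-dec_; _⊎-dec_)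
  open CountFilter

  pathEdge : ℕ → ℕ × ℕ
  pathEdge i = suc i , suc (suc i)

  spokeEdge : ℕ → ℕ × ℕ
  spokeEdge i = 0 , suc i

  fanEdges-applyUpTo : ∀ n → fanEdges n ≡ applyUpTo pathEdge (n ∸ 1) ++ applyUpTo spokeEdge n
  fanEdges-applyUpTo n = cong₂ _++_ (map-upTo pathEdge (n ∸ 1)) (map-upTo spokeEdge n)

  length-fanEdges : ∀ n → length (fanEdges n) ≡ (n ∸ 1) + n
  length-fanEdges n = trans (length-++ (map pathEdge (upTo (n ∸ 1))))
    (cong₂ _+_ (trans (length-map pathEdge (upTo (n ∸ 1))) (length-upTo (n ∸ 1)))
               (trans (length-map spokeEdge (upTo n)) (length-upTo n)))

  incident? : ∀ v → Decidable λ (e : ℕ × ℕ) → proj₁ e ≡ v ⊎ proj₂ e ≡ v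
  incident? v e = (proj₁ e ≟ v) ⊎-dec (proj₂ e ≟ v)

  joins? : ∀ u v → Decidable λ (e : ℕ × ℕ) → proj₁ e ≡ u × proj₂ e ≡ v ⊎ proj₁ e ≡ v × proj₂ e ≡ u
  joins? u v e = ((proj₁ e ≟ u) ×-dec (proj₂ e ≟ v)) ⊎-dec ((proj₁ e ≟ v) ×-dec (proj₂ e ≟ u))

  degree-++ : ∀ xs ys v → degree (xs ++ ys) v ≡ degree xs v + degree ys v
  degree-++ xs ys v = trans (cong length (filter-++ (incident? v) xs ys)) (length-++ (filter (incident? v) xs))

  mult-++ : ∀ xs ys u v → mult (xs ++ ys) u v ≡ mult xs u v + mult ys u v
  mult-++ xs ys u v = trans (cong length (filter-++ (joins? u v) xs ys)) (length-++ (filter (joins? u v) xs))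

  deg-split : ∀ n v → deg n v ≡ degree (applyUpTo pathEdge (n ∸ 1)) v + degree (applyUpTo spokeEdge n) v
  deg-split n v = trans (cong (λ es → degree es v) (fanEdges-applyUpTo n)) (degree-++ (applyUpTo pathEdge (n ∸ 1)) (applyUpTo spokeEdge n) v)

  mult-split : ∀ n u v → mult (fanEdges n) u v ≡ mult (applyUpTo pathEdge (n ∸ 1)) u v + mult (applyUpTo spokeEdge n) u v
  mult-split n u v = trans (cong (λ es → mult es u v) (fanEdges-applyUpTo n)) (mult-++ (applyUpTo pathEdge (n ∸ 1)) (applyUpTo spokeEdge n) u v)

  deg-sink : ∀ n → deg n 0 ≡ n
  deg-sink n = trans (deg-split n 0)
    (cong₂ _+_ (count-none (incident? 0) pathEdge (n ∸ 1) λ { _ _ (inj₁ ()) ; _ _ (inj₂ ()) })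
               (count-all (incident? 0) spokeEdge n λ _ _ → inj₁ refl))

  -- Vertex j + 1 of the fan has a left path neighbour iff 0 < j, and a right one iff j + 2 ≤ n.
  hasLeft : ℕ → ℕ
  hasLeft zero    = 0
  hasLeft (suc _) = 1

  hasRight : ℕ → ℕ → ℕ
  hasRight (suc n)       (suc j) = hasRight n j
  hasRight (suc (suc n)) zero    = 1
  hasRight _             _       = 0

  pathDeg : ℕ → ℕ → ℕ
  pathDeg n j = hasLeft j + hasRight n j

  hasRight≡1 : ∀ n j → suc j < n → hasRight n j ≡ 1
  hasRight≡1 (suc n)       (suc j) (s≤s j+1<n) = hasRight≡1 n j j+1<n
  hasRight≡1 (suc (suc n)) zero    _           = refl
  hasRight≡1 (suc zero)    zero    (s≤s ())

  hasRight≡0 : ∀ n j → n ≤ suc j → hasRight n j ≡ 0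
  hasRight≡0 zero                j       _         = refl
  hasRight≡0 (suc zero)          zero    _         = refl
  hasRight≡0 (suc zero)          (suc j) _         = refl
  hasRight≡0 (suc (suc n))       (suc j) (s≤s n≤j) = hasRight≡0 (suc n) j n≤j

  hasLeft≤1 : ∀ j → hasLeft j ≤ 1
  hasLeft≤1 zero    = z≤n
  hasLeft≤1 (suc j) = ≤-refl

  hasRight≤1 : ∀ n j → hasRight n j ≤ 1
  hasRight≤1 (suc n)       (suc j) = hasRight≤1 n j
  hasRight≤1 (suc (suc n)) zero    = ≤-refl
  hasRight≤1 zero          _       = z≤n
  hasRight≤1 (suc zero)    zero    = z≤n

  pathDeg≤2 : ∀ n j → pathDeg n j ≤ 2
  pathDeg≤2 n j = +-mono-≤ (hasLeft≤1 j) (hasRight≤1 n j)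

  pathDeg-notLast : ∀ n j → suc j < n → 1 ≤ pathDeg n j
  pathDeg-notLast n j j+1<n rewrite hasRight≡1 n j j+1<n = m≤n+m 1 (hasLeft j)

  pathDeg-inner : ∀ n j → suc (suc j) < n → 2 ≤ pathDeg n (suc j)
  pathDeg-inner n j j+2<n rewrite hasRight≡1 n (suc j) j+2<n = ≤-refl

  private
    degree-spokes : ∀ n j → j < n → degree (applyUpTo spokeEdge n) (suc j) ≡ 1
    degree-spokes n j j<n = count-one (incident? (suc j)) spokeEdge n j j<n (inj₂ refl) only
      where
      only : ∀ i → i < n → 0 ≡ suc j ⊎ suc i ≡ suc j → i ≡ j
      only i _ (inj₂ e) = suc-injective e

    degree-path : ∀ n j → j < n → degree (applyUpTo pathEdge (n ∸ 1)) (suc j) ≡ pathDeg n j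
    degree-path (suc zero) zero _ = refl
    degree-path (suc (suc n)) zero _ = count-one (incident? 1) pathEdge (suc n) 0 z<s (inj₁ refl) only
      where
      only : ∀ i → i < suc n → suc i ≡ 1 ⊎ suc (suc i) ≡ 1 → i ≡ 0
      only i _ (inj₁ e) = suc-injective e
      only i _ (inj₂ ())
    degree-path (suc n) (suc j) (s≤s j<n) with suc j <? n
    ... | yes j+1<n = trans (count-two (incident? (suc (suc j))) pathEdge n j j+1<n (inj₂ refl) (inj₁ refl) only)
                            (cong suc (sym (hasRight≡1 n j j+1<n)))
      where
      only : ∀ i → i < n → suc i ≡ suc (suc j) ⊎ suc (suc i) ≡ suc (suc j) → i ≡ j ⊎ i ≡ suc j
      only i _ (inj₁ e) = inj₂ (suc-injective e)
      only i _ (inj₂ e) = inj₁ (suc-injective (suc-injective e))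
    ... | no j+1≮n = trans (count-one (incident? (suc (suc j))) pathEdge n j j<n (inj₂ refl) only)
                           (cong suc (sym (hasRight≡0 n j (≮⇒≥ j+1≮n))))
      where
      only : ∀ i → i < n → suc i ≡ suc (suc j) ⊎ suc (suc i) ≡ suc (suc j) → i ≡ j
      only i i<n (inj₁ refl) = ⊥-elim (j+1≮n i<n)
      only i _   (inj₂ e)    = suc-injective (suc-injective e)

    mult-spokes : ∀ n a b → mult (applyUpTo spokeEdge n) (suc a) (suc b) ≡ 0
    mult-spokes n a b = count-none (joins? (suc a) (suc b)) spokeEdge n λ { _ _ (inj₁ (() , _)) ; _ _ (inj₂ (() , _)) }

  deg-suc : ∀ n j → j < n → deg n (suc j) ≡ suc (pathDeg n j)
  deg-suc n j j<n = trans (deg-split n (suc j)) (trans (cong₂ _+_ (degree-path n j j<n) (degree-spokes n j j<n)) (+-comm (pathDeg n j) 1))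

  mult-right : ∀ n a → suc a < n → mult (fanEdges n) (suc a) (suc (suc a)) ≡ 1
  mult-right (suc n) a (s≤s a+1<n) = trans (mult-split (suc n) _ _)
    (cong₂ _+_ (count-one (joins? (suc a) (suc (suc a))) pathEdge n a a+1<n (inj₁ (refl , refl)) only) (mult-spokes (suc n) a (suc a)))
    where
    only : ∀ i → i < n → suc i ≡ suc a × suc (suc i) ≡ suc (suc a) ⊎ suc i ≡ suc (suc a) × suc (suc i) ≡ suc a → i ≡ a
    only i _ (inj₁ (e , _)) = suc-injective e
    only i _ (inj₂ (refl , ()))

  mult-left : ∀ n a → suc a < n → mult (fanEdges n) (suc (suc a)) (suc a) ≡ 1
  mult-left (suc n) a (s≤s a+1<n) = trans (mult-split (suc n) _ _)
    (cong₂ _+_ (count-one (joins? (suc (suc a)) (suc a)) pathEdge n a a+1<n (inj₂ (refl , refl)) only) (mult-spokes (suc n) (suc a) a))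
    where
    only : ∀ i → i < n → suc i ≡ suc (suc a) × suc (suc i) ≡ suc a ⊎ suc i ≡ suc a × suc (suc i) ≡ suc (suc a) → i ≡ a
    only i _ (inj₂ (e , _)) = suc-injective e
    only i _ (inj₁ (refl , ()))

  mult-far : ∀ n a b → b ≢ suc a → a ≢ suc b → mult (fanEdges n) (suc a) (suc b) ≡ 0
  mult-far n a b b≢a+1 a≢b+1 = trans (mult-split n _ _)
    (cong₂ _+_ (count-none (joins? (suc a) (suc b)) pathEdge (n ∸ 1) notJoined) (mult-spokes n a b))
    where
    notJoined : ∀ i → i < n ∸ 1 → ¬ (suc i ≡ suc a × suc (suc i) ≡ suc b ⊎ suc i ≡ suc b × suc (suc i) ≡ suc a)
    notJoined i _ (inj₁ (refl , refl)) = b≢a+1 refl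
    notJoined i _ (inj₂ (refl , refl)) = a≢b+1 refl

module Configuration where

  open Fan

  ≡ᵇ-true : ∀ {m n} → m ≡ n → (m ≡ᵇ n) ≡ true
  ≡ᵇ-true {m} {n} m≡n = Equivalence.to T-≡ (≡⇒≡ᵇ m n m≡n)

  ≡ᵇ-false : ∀ {m n} → m ≢ n → (m ≡ᵇ n) ≡ false
  ≡ᵇ-false {m} {n} m≢n with m ≡ᵇ n in eq
  ... | false = refl
  ... | true  = ⊥-elim (m≢n (≡ᵇ⇒≡ m n (subst T (sym eq) tt)))

  -- Entry j of a configuration, with the junk value 0 for j ≥ n.
  at : ∀ {n} → Vec ℕ n → ℕ → ℕ
  at []       _       = 0
  at (x ∷ xs) zero    = x
  at (x ∷ xs) (suc j) = at xs j

  at-lookup : ∀ {n} (c : Vec ℕ n) f → lookup c f ≡ at c (toℕ f)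
  at-lookup (x ∷ c) fzero    = refl
  at-lookup (x ∷ c) (fsuc f) = at-lookup c f

  at-outside : ∀ {n} (c : Vec ℕ n) j → n ≤ j → at c j ≡ 0
  at-outside []      j       _         = refl
  at-outside (x ∷ c) (suc j) (s≤s n≤j) = at-outside c j n≤j

  at-ext : ∀ {n} (c d : Vec ℕ n) → (∀ j → j < n → at c j ≡ at d j) → c ≡ d
  at-ext []      []      _  = refl
  at-ext (x ∷ c) (y ∷ d) eq = cong₂ _∷_ (eq 0 z<s) (at-ext c d λ j j<n → eq (suc j) (s≤s j<n))

  build : ∀ n → (ℕ → ℕ) → Vec ℕ n
  build zero    h = []
  build (suc n) h = h 0 ∷ build n (h ∘ suc)

  at-build : ∀ n h j → j < n → at (build n h) j ≡ h j
  at-build (suc n) h zero    _         = refl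
  at-build (suc n) h (suc j) (s≤s j<n) = at-build n (h ∘ suc) j j<n

  at-tabulate : ∀ {n} (h : Fin n → ℕ) j (j<n : j < n) → at (tabulate h) j ≡ h (fromℕ< j<n)
  at-tabulate h j j<n = begin
    at (tabulate h) j                    ≡⟨ cong (at (tabulate h)) (sym (toℕ-fromℕ< j<n)) ⟩
    at (tabulate h) (toℕ (fromℕ< j<n))   ≡⟨ sym (at-lookup (tabulate h) (fromℕ< j<n)) ⟩
    lookup (tabulate h) (fromℕ< j<n)     ≡⟨ lookup∘tabulate h (fromℕ< j<n) ⟩
    h (fromℕ< j<n)                       ∎
    where
    open ≡-Reasoning

  _≤ᶜ_ : ∀ {n} → Vec ℕ n → Vec ℕ n → Set
  c ≤ᶜ d = ∀ j → at c j ≤ at d j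

  at-addGrain-self : ∀ {n} (c : Vec ℕ n) f → at (c [ f ]%= suc) (toℕ f) ≡ suc (at c (toℕ f))
  at-addGrain-self (x ∷ c) fzero    = refl
  at-addGrain-self (x ∷ c) (fsuc f) = at-addGrain-self c f

  at-addGrain-other : ∀ {n} (c : Vec ℕ n) f j → j ≢ toℕ f → at (c [ f ]%= suc) j ≡ at c j
  at-addGrain-other (x ∷ c) fzero    zero    j≢f = ⊥-elim (j≢f refl)
  at-addGrain-other (x ∷ c) fzero    (suc j) _   = refl
  at-addGrain-other (x ∷ c) (fsuc f) zero    _   = refl
  at-addGrain-other (x ∷ c) (fsuc f) (suc j) j≢f = at-addGrain-other c f j (j≢f ∘ cong suc)

  addGrain-≥ : ∀ {n} (c : Vec ℕ n) f → c ≤ᶜ (c [ f ]%= suc)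
  addGrain-≥ (x ∷ c) fzero    zero    = n≤1+n x
  addGrain-≥ (x ∷ c) fzero    (suc j) = ≤-refl
  addGrain-≥ (x ∷ c) (fsuc f) zero    = ≤-refl
  addGrain-≥ (x ∷ c) (fsuc f) (suc j) = addGrain-≥ c f j

  at-topple : ∀ n c f j → j < n → at (topple n c f) j ≡
    (if j ≡ᵇ toℕ f then at c j ∸ deg n (label f) else at c j + mult (fanEdges n) (label f) (suc j))
  at-topple n c f j j<n = trans (at-tabulate _ j j<n) (entry (fromℕ< j<n) (toℕ-fromℕ< j<n))
    where
    entry : ∀ g → toℕ g ≡ j →
      (if toℕ g ≡ᵇ toℕ f then lookup c g ∸ deg n (label f) else lookup c g + mult (fanEdges n) (label f) (label g)) ≡
      (if j ≡ᵇ toℕ f then at c j ∸ deg n (label f) else at c j + mult (fanEdges n) (label f) (suc j))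
    entry g refl rewrite at-lookup c g = refl

  at-topple-self : ∀ n c f → at (topple n c f) (toℕ f) ≡ at c (toℕ f) ∸ suc (pathDeg n (toℕ f))
  at-topple-self n c f rewrite at-topple n c f (toℕ f) (toℕ<n f) | ≡ᵇ-true (refl {x = toℕ f}) =
    cong (at c (toℕ f) ∸_) (deg-suc n (toℕ f) (toℕ<n f))

  at-topple-other : ∀ n c f j → j < n → j ≢ toℕ f →
                    at (topple n c f) j ≡ at c j + mult (fanEdges n) (label f) (suc j)
  at-topple-other n c f j j<n j≢f rewrite at-topple n c f j j<n | ≡ᵇ-false j≢f = refl

  topple-≥ : ∀ n c f j → j < n → j ≢ toℕ f → at c j ≤ at (topple n c f) j
  topple-≥ n c f j j<n j≢f rewrite at-topple-other n c f j j<n j≢f = m≤m+n _ _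

  at-topple-right : ∀ n c f → suc (toℕ f) < n → at (topple n c f) (suc (toℕ f)) ≡ at c (suc (toℕ f)) + 1
  at-topple-right n c f f+1<n = trans (at-topple-other n c f (suc (toℕ f)) f+1<n 1+n≢n)
    (cong (at c (suc (toℕ f)) +_) (mult-right n (toℕ f) f+1<n))

  at-topple-left : ∀ n c f j → toℕ f ≡ suc j → at (topple n c f) j ≡ at c j + 1
  at-topple-left n c f j f≡j+1 = trans (at-topple-other n c f j (<-trans (n<1+n j) j+1<n) λ j≡f → 1+n≢n (trans (sym f≡j+1) (sym j≡f)))
    (cong (at c j +_) (trans (cong (λ i → mult (fanEdges n) (suc i) (suc j)) f≡j+1) (mult-left n j j+1<n)))
    where
    j+1<n : suc j < n
    j+1<n = subst (_< n) f≡j+1 (toℕ<n f)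

  at-topple-far : ∀ n c f j → j < n → j ≢ toℕ f → j ≢ suc (toℕ f) → toℕ f ≢ suc j →
                  at (topple n c f) j ≡ at c j
  at-topple-far n c f j j<n j≢f j≢f+1 f≢j+1 = trans (at-topple-other n c f j j<n j≢f)
    (trans (cong (at c j +_) (mult-far n (toℕ f) j j≢f+1 f≢j+1)) (+-identityʳ _))

-- By Dhar's burning criterion a stable configuration is recurrent iff no set S of non-sink
-- vertices is forbidden (c_v < deg_S v for all v ∈ S).  On the fan it suffices to look at
-- intervals [l, r], l < r, of the path, forbidden iff c_l = c_r = 0 and c_i ≤ 1 inside.
module ForbiddenInterval where

  open Fan
  open Configuration

  AllowedInterval : ∀ {n} → Vec ℕ n → ℕ → ℕ → Set
  AllowedInterval c l r = 1 ≤ at c l ⊎ 1 ≤ at c r ⊎ ∃ λ i → l < i × i < r × 2 ≤ at c i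

  NoForbiddenInterval : ∀ {n} → Vec ℕ n → Set
  NoForbiddenInterval {n} c = ∀ l r → l < r → r < n → AllowedInterval c l r

  allowed-mono-on : ∀ {n} (c d : Vec ℕ n) {l r} → l < r → (∀ j → l ≤ j → j ≤ r → at c j ≤ at d j) →
                    AllowedInterval c l r → AllowedInterval d l r
  allowed-mono-on c d l<r c≤d (inj₁ cl≥1)        = inj₁ (≤-trans cl≥1 (c≤d _ ≤-refl (<⇒≤ l<r)))
  allowed-mono-on c d l<r c≤d (inj₂ (inj₁ cr≥1)) = inj₂ (inj₁ (≤-trans cr≥1 (c≤d _ (<⇒≤ l<r) ≤-refl)))
  allowed-mono-on c d l<r c≤d (inj₂ (inj₂ (i , l<i , i<r , ci≥2))) =
    inj₂ (inj₂ (i , l<i , i<r , ≤-trans ci≥2 (c≤d i (<⇒≤ l<i) (<⇒≤ i<r))))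

  noForbidden-mono : ∀ {n} (c d : Vec ℕ n) → c ≤ᶜ d → NoForbiddenInterval c → NoForbiddenInterval d
  noForbidden-mono c d c≤d noF l r l<r r<n = allowed-mono-on c d l<r (λ j _ _ → c≤d j) (noF l r l<r r<n)

  -- Toppling a vertex of [l, r] sends a grain to a neighbour inside [l, r], which then
  -- witnesses that [l, r] stays allowed.
  module _ {n} (c : Vec ℕ n) (f : Fin n) (noF : NoForbiddenInterval c) where

    private
      d = topple n c f

      grows : ∀ {j} → j < n → j ≢ toℕ f → at c j ≤ at d j
      grows {j} j<n = topple-≥ n c f j j<n

    allowed-topple-leftEnd : ∀ l r → l < r → r < n → toℕ f ≡ l → AllowedInterval d l r
    allowed-topple-leftEnd l r l<r r<n refl with m≤n⇒m<n∨m≡n l<r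
    ... | inj₂ l+1≡r = inj₂ (inj₁ (subst (λ t → 1 ≤ at d t) l+1≡r (subst (1 ≤_) (sym (at-topple-right n c f f+1<n)) (m≤n+m 1 _))))
      where
      f+1<n : suc (toℕ f) < n
      f+1<n = subst (_< n) (sym l+1≡r) r<n
    ... | inj₁ l+1<r with noF (suc l) r l+1<r r<n
    ...   | inj₁ c≥1 = inj₂ (inj₂ (suc l , ≤-refl , l+1<r , subst (2 ≤_) (sym (at-topple-right n c f (<-trans l+1<r r<n))) (+-monoˡ-≤ 1 c≥1)))
    ...   | inj₂ (inj₁ cr≥1) = inj₂ (inj₁ (≤-trans cr≥1 (grows r<n λ r≡l → <-irrefl (sym r≡l) l<r)))
    ...   | inj₂ (inj₂ (i , l+1<i , i<r , ci≥2)) =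
      inj₂ (inj₂ (i , l<i , i<r , ≤-trans ci≥2 (grows (<-trans i<r r<n) λ i≡l → <-irrefl (sym i≡l) l<i)))
      where
      l<i = <-trans (n<1+n l) l+1<i

    allowed-topple-inner : ∀ l r b → l < r → r < n → toℕ f ≡ suc b → l ≤ b → suc b ≤ r → AllowedInterval d l r
    allowed-topple-inner l r b l<r r<n f≡b+1 l≤b b<r with m≤n⇒m<n∨m≡n l≤b
    ... | inj₂ refl = inj₁ (subst (1 ≤_) (sym (at-topple-left n c f l f≡b+1)) (m≤n+m 1 _))
    ... | inj₁ l<b with noF l b l<b (<-trans b<r r<n)
    ...   | inj₁ cl≥1 = inj₁ (≤-trans cl≥1 (grows (<-trans l<r r<n) λ l≡f → <-irrefl (trans l≡f f≡b+1) (<-trans l<b (n<1+n b))))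
    ...   | inj₂ (inj₁ cb≥1) = inj₂ (inj₂ (b , l<b , b<r , subst (2 ≤_) (sym (at-topple-left n c f b f≡b+1)) (+-monoˡ-≤ 1 cb≥1)))
    ...   | inj₂ (inj₂ (i , l<i , i<b , ci≥2)) =
      inj₂ (inj₂ (i , l<i , <-trans i<b b<r ,
                  ≤-trans ci≥2 (grows (<-trans (<-trans i<b b<r) r<n) λ i≡f → <-irrefl (trans i≡f f≡b+1) (<-trans i<b (n<1+n b)))))

    noForbidden-topple : NoForbiddenInterval d
    noForbidden-topple l r l<r r<n with <-cmp (toℕ f) l
    ... | tri≈ _ f≡l _ = allowed-topple-leftEnd l r l<r r<n f≡l
    ... | tri< f<l _ _ = allowed-mono-on c d l<r
            (λ j l≤j j≤r → grows (≤-<-trans j≤r r<n) λ j≡f → <-irrefl refl (<-≤-trans f<l (subst (l ≤_) j≡f l≤j))) (noF l r l<r r<n)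
    ... | tri> _ _ l<f with ≤-<-connex (toℕ f) r
    ...   | inj₂ r<f = allowed-mono-on c d l<r
            (λ j l≤j j≤r → grows (≤-<-trans j≤r r<n) λ j≡f → <-irrefl j≡f (≤-<-trans j≤r r<f)) (noF l r l<r r<n)
    ...   | inj₁ f≤r = inner (toℕ f) refl l<f f≤r
      where
      inner : ∀ a → toℕ f ≡ a → l < a → a ≤ r → AllowedInterval d l r
      inner (suc b) f≡b+1 (s≤s l≤b) b<r = allowed-topple-inner l r b l<r r<n f≡b+1 l≤b b<r

  noForbidden-topples : ∀ {n} {c d : Vec ℕ n} → Star (ToppleStep n) c d → NoForbiddenInterval c → NoForbiddenInterval d
  noForbidden-topples ε                noF = noF
  noForbidden-topples (step c f _ ◅ s) noF = noForbidden-topples s (noForbidden-topple c f noF)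

  noForbidden-reach : ∀ {n} {c d : Vec ℕ n} → Reach n c d → NoForbiddenInterval c → NoForbiddenInterval d
  noForbidden-reach ε noF = noF
  noForbidden-reach (Transition.trans c _ f _ (topples , _) ◅ s) noF =
    noForbidden-reach s (noForbidden-topples topples (noForbidden-mono c (c [ f ]%= suc) (addGrain-≥ c f) noF))

module Stability where

  open Fan
  open Configuration
  open ForbiddenInterval

  stable⇒≤pathDeg : ∀ n (c : Vec ℕ n) → Stable n c → ∀ j → j < n → at c j ≤ pathDeg n j
  stable⇒≤pathDeg n c stable j j<n = s≤s⁻¹ (subst₂ _<_ (trans (at-lookup c g) (cong (at c) (toℕ-fromℕ< j<n)))
    (trans (cong (deg n ∘ suc) (toℕ-fromℕ< j<n)) (deg-suc n j j<n)) (stable g))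
    where g = fromℕ< j<n

  ≤pathDeg⇒stable : ∀ n (c : Vec ℕ n) → (∀ j → j < n → at c j ≤ pathDeg n j) → Stable n c
  ≤pathDeg⇒stable n c bounded g =
    subst₂ _<_ (sym (at-lookup c g)) (sym (deg-suc n (toℕ g) (toℕ<n g))) (s≤s (bounded (toℕ g) (toℕ<n g)))

  stable-≤ᶜ : ∀ n (c d : Vec ℕ n) → c ≤ᶜ d → Stable n d → Stable n c
  stable-≤ᶜ n c d c≤d stable = ≤pathDeg⇒stable n c λ j j<n → ≤-trans (c≤d j) (stable⇒≤pathDeg n d stable j j<n)

  reach-stable : ∀ n {c d : Vec ℕ n} → Stable n c → Reach n c d → Stable n d
  reach-stable n stable ε = stable
  reach-stable n _ (Transition.trans _ _ _ _ (_ , stable) ◅ s) = reach-stable n stable s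

  maxStable : ∀ n → Vec ℕ n
  maxStable n = build n (pathDeg n)

  at-maxStable : ∀ n j → j < n → at (maxStable n) j ≡ pathDeg n j
  at-maxStable n = at-build n (pathDeg n)

  maxStable-stable : ∀ n → Stable n (maxStable n)
  maxStable-stable n = ≤pathDeg⇒stable n (maxStable n) λ j j<n → ≤-reflexive (at-maxStable n j j<n)

  stable⇒≤maxStable : ∀ n (c : Vec ℕ n) → Stable n c → c ≤ᶜ maxStable n
  stable⇒≤maxStable n c stable j with j <? n
  ... | yes j<n = subst (at c j ≤_) (sym (at-maxStable n j j<n)) (stable⇒≤pathDeg n c stable j j<n)
  ... | no j≮n  = subst (_≤ at (maxStable n) j) (sym (at-outside c j (≮⇒≥ j≮n))) z≤n

  maxStable-noForbidden : ∀ n → NoForbiddenInterval (maxStable n)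
  maxStable-noForbidden n l r l<r r<n with m≤n⇒m<n∨m≡n l<r
  ... | inj₂ l+1≡r = inj₁ (subst (1 ≤_) (sym (at-maxStable n l (<-trans l<r r<n))) (pathDeg-notLast n l (subst (_< n) (sym l+1≡r) r<n)))
  ... | inj₁ l+1<r = inj₂ (inj₂ (suc l , ≤-refl , l+1<r ,
          subst (2 ≤_) (sym (at-maxStable n (suc l) (<-trans l+1<r r<n))) (pathDeg-inner n l (≤-<-trans l+1<r r<n))))

  ≤ᶜ-∷ : ∀ {n u v} {xs ys : Vec ℕ n} → u ≤ v → xs ≤ᶜ ys → (u ∷ xs) ≤ᶜ (v ∷ ys)
  ≤ᶜ-∷ u≤v _     zero    = u≤v
  ≤ᶜ-∷ _   xs≤ys (suc j) = xs≤ys j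

  -- Below a stable bound b, adding a grain never topples.
  GrainAdded : ∀ {n} → Vec ℕ n → Vec ℕ n → Vec ℕ n → Set
  GrainAdded {n} b x y = Σ (Fin n) (λ f → y ≡ x [ f ]%= suc) × y ≤ᶜ b

  private
    raise : ∀ {n} k u v {xs bs : Vec ℕ n} → u + k ≡ v → xs ≤ᶜ bs →
            Star (GrainAdded (v ∷ bs)) (u ∷ xs) (v ∷ xs)
    raise zero u v u+0≡v _ rewrite +-identityʳ u | u+0≡v = ε
    raise (suc k) u v u+k+1≡v xs≤bs =
      ((fzero , refl) , ≤ᶜ-∷ (subst (suc u ≤_) u+k+1≡v (m<m+n u z<s)) xs≤bs)
      ◅ raise k (suc u) v (trans (sym (+-suc u k)) u+k+1≡v) xs≤bs

    addToTail : ∀ {n} v {bs xs ys : Vec ℕ n} → Star (GrainAdded bs) xs ys → Star (GrainAdded (v ∷ bs)) (v ∷ xs) (v ∷ ys)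
    addToTail v ε = ε
    addToTail v (((f , refl) , y≤b) ◅ s) = ((fsuc f , refl) , ≤ᶜ-∷ ≤-refl y≤b) ◅ addToTail v s

    fill : ∀ {n} (x b : Vec ℕ n) → x ≤ᶜ b → Star (GrainAdded b) x b
    fill []      []      _   = ε
    fill (u ∷ x) (v ∷ b) x≤b =
      raise (v ∸ u) u v (m+[n∸m]≡n (x≤b 0)) (x≤b ∘ suc) ◅◅ addToTail v (fill x b (x≤b ∘ suc))

    grainsAdded⇒reach : ∀ n (b x y : Vec ℕ n) → Stable n b → x ≤ᶜ b → Star (GrainAdded b) x y → Reach n x y
    grainsAdded⇒reach n b x .x _ _ ε = ε
    grainsAdded⇒reach n b x y b-stable x≤b (((f , refl) , x'≤b) ◅ s) =
      Transition.trans x x' f (stable-≤ᶜ n x b x≤b b-stable) (ε , stable-≤ᶜ n x' b x'≤b b-stable)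
        ◅ grainsAdded⇒reach n b x' y b-stable x'≤b s
      where x' = x [ f ]%= suc

  reach-≤ᶜ : ∀ n {x b : Vec ℕ n} → x ≤ᶜ b → Stable n b → Reach n x b
  reach-≤ᶜ n {x} {b} x≤b b-stable = grainsAdded⇒reach n b x b b-stable x≤b (fill x b x≤b)

  reach-maxStable : ∀ n (c : Vec ℕ n) → Stable n c → Reach n c (maxStable n)
  reach-maxStable n c stable = reach-≤ᶜ n (stable⇒≤maxStable n c stable) (maxStable-stable n)

module Avalanche where

  open Fan
  open Configuration
  open Stability

  -- wave g t is the configuration g with one grain added at 0, after vertices 0, …, t-1 toppled
  -- in this order: 1 … 1 0 (g t + 1) (g (t+1)) …
  wave : (ℕ → ℕ) → ℕ → ℕ → ℕ
  wave g zero          zero    = suc (g 0)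
  wave g zero          (suc j) = g (suc j)
  wave g (suc t)       (suc j) = wave (g ∘ suc) t j
  wave g (suc zero)    zero    = 0
  wave g (suc (suc t)) zero    = 1

  wave-behind : ∀ g {t} j → suc j < t → wave g t j ≡ 1
  wave-behind g {suc (suc t)} zero    _             = refl
  wave-behind g {suc t}       (suc j) (s≤s j+1<t) = wave-behind (g ∘ suc) j j+1<t

  wave-last : ∀ g t → wave g (suc t) t ≡ 0
  wave-last g zero    = refl
  wave-last g (suc t) = wave-last (g ∘ suc) t

  wave-front : ∀ g t → wave g t t ≡ suc (g t)
  wave-front g zero    = refl
  wave-front g (suc t) = wave-front (g ∘ suc) t

  wave-ahead : ∀ g {t} j → t < j → wave g t j ≡ g j
  wave-ahead g {zero}  (suc j) _         = refl
  wave-ahead g {suc t} (suc j) (s≤s t<j) = wave-ahead (g ∘ suc) j t<j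

  -- If c is saturated (c_j = pathDeg n j) on 0, …, r, a grain added at 0 topples 0, …, r in turn.
  module Run {n} (c : Vec ℕ n) (r : ℕ) (r<n : r < n) (saturated : ∀ j → j ≤ r → at c j ≡ pathDeg n j) where

    profile : ℕ → Vec ℕ n
    profile t = build n (wave (at c) t)

    at-profile : ∀ t j → j < n → at (profile t) j ≡ wave (at c) t j
    at-profile t = at-build n (wave (at c) t)

    private
      toppleStep : ∀ t → t ≤ r → ToppleStep n (profile t) (profile (suc t))
      toppleStep t t≤r = subst (ToppleStep n (profile t)) (at-ext _ _ next) (step (profile t) f legal)
        where
        t<n = ≤-<-trans t≤r r<n
        f = fromℕ< t<n
        f≡t : toℕ f ≡ t
        f≡t = toℕ-fromℕ< t<n
        g = at c
        d = topple n (profile t) f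

        legal : deg n (label f) ≤ lookup (profile t) f
        legal rewrite at-lookup (profile t) f | f≡t | at-profile t t t<n | wave-front g t | saturated t t≤r
                    | deg-suc n t t<n = ≤-refl

        next : ∀ j → j < n → at d j ≡ at (profile (suc t)) j
        next j j<n rewrite at-profile (suc t) j j<n with <-cmp j t
        ... | tri≈ _ refl _ = begin
          at d j                          ≡⟨ cong (at d) (sym f≡t) ⟩
          at d (toℕ f)                    ≡⟨ at-topple-self n (profile t) f ⟩
          at (profile t) (toℕ f) ∸ suc (pathDeg n (toℕ f)) ≡⟨ cong (λ i → at (profile t) i ∸ suc (pathDeg n i)) f≡t ⟩
          at (profile t) j ∸ suc (pathDeg n j) ≡⟨ cong (_∸ suc (pathDeg n j)) (trans (at-profile t j j<n) (wave-front g j)) ⟩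
          suc (g j) ∸ suc (pathDeg n j)   ≡⟨ cong (λ x → suc x ∸ suc (pathDeg n j)) (saturated j t≤r) ⟩
          suc (pathDeg n j) ∸ suc (pathDeg n j) ≡⟨ n∸n≡0 (suc (pathDeg n j)) ⟩
          0                               ≡⟨ sym (wave-last g j) ⟩
          wave g (suc j) j                ∎
          where open ≡-Reasoning
        ... | tri< j<t _ _ with m≤n⇒m<n∨m≡n j<t
        ...   | inj₂ refl = begin
          at d j               ≡⟨ at-topple-left n (profile t) f j f≡t ⟩
          at (profile t) j + 1 ≡⟨ cong (_+ 1) (trans (at-profile t j j<n) (wave-last g j)) ⟩
          1                    ≡⟨ sym (wave-behind g j ≤-refl) ⟩
          wave g (suc t) j     ∎
          where open ≡-Reasoning
        ...   | inj₁ j+1<t = begin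
          at d j           ≡⟨ at-topple-far n (profile t) f j j<n (λ j≡f → <-irrefl (trans j≡f f≡t) j<t)
                                (λ j≡f+1 → <-asym j<t (subst (t <_) (sym (trans j≡f+1 (cong suc f≡t))) (n<1+n t)))
                                (λ f≡j+1 → <-irrefl (trans (sym f≡j+1) f≡t) j+1<t) ⟩
          at (profile t) j ≡⟨ trans (at-profile t j j<n) (wave-behind g j j+1<t) ⟩
          1                ≡⟨ sym (wave-behind g j (<-trans j+1<t (n<1+n t))) ⟩
          wave g (suc t) j ∎
          where open ≡-Reasoning
        next j j<n | tri> _ _ t<j with m≤n⇒m<n∨m≡n t<j
        ...   | inj₂ refl = begin
          at d j               ≡⟨ cong (at d) (cong suc (sym f≡t)) ⟩
          at d (suc (toℕ f))   ≡⟨ at-topple-right n (profile t) f (subst (λ i → suc i < n) (sym f≡t) j<n) ⟩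
          at (profile t) (suc (toℕ f)) + 1 ≡⟨ cong (λ i → at (profile t) (suc i) + 1) f≡t ⟩
          at (profile t) j + 1 ≡⟨ cong (_+ 1) (trans (at-profile t j j<n) (wave-ahead g j t<j)) ⟩
          g j + 1              ≡⟨ +-comm (g j) 1 ⟩
          suc (g j)            ≡⟨ sym (wave-front g j) ⟩
          wave g (suc t) j     ∎
          where open ≡-Reasoning
        ...   | inj₁ t+1<j = begin
          at d j           ≡⟨ at-topple-far n (profile t) f j j<n (λ j≡f → <-irrefl (sym (trans j≡f f≡t)) t<j)
                                (λ j≡f+1 → <-irrefl (sym (trans j≡f+1 (cong suc f≡t))) t+1<j)
                                (λ f≡j+1 → <-asym t<j (subst (j <_) (trans (sym f≡j+1) f≡t) (n<1+n j))) ⟩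
          at (profile t) j ≡⟨ trans (at-profile t j j<n) (wave-ahead g j t<j) ⟩
          g j              ≡⟨ sym (wave-ahead g j t+1<j) ⟩
          wave g (suc t) j ∎
          where open ≡-Reasoning

      toppled : ∀ t → t ≤ suc r → Star (ToppleStep n) (profile 0) (profile t)
      toppled zero    _         = ε
      toppled (suc t) t+1≤r+1 = toppled t (≤-trans (n≤1+n t) t+1≤r+1) ◅◅ (toppleStep t (s≤s⁻¹ t+1≤r+1) ◅ ε)

      0<n : 0 < n
      0<n = ≤-<-trans z≤n r<n

      start : c [ fromℕ< 0<n ]%= suc ≡ profile 0
      start = at-ext _ _ λ where
        zero    j<n → trans (subst (λ i → at (c [ fromℕ< 0<n ]%= suc) i ≡ suc (at c i)) (toℕ-fromℕ< 0<n) (at-addGrain-self c _))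
                            (sym (at-profile 0 0 j<n))
        (suc j) j<n → trans (at-addGrain-other c _ (suc j) λ e → 1+n≢0 (trans e (toℕ-fromℕ< 0<n)))
                            (sym (at-profile 0 (suc j) j<n))

    final : Vec ℕ n
    final = profile (suc r)

    at-final-behind : ∀ j → j < r → at final j ≡ 1
    at-final-behind j j<r = trans (at-profile (suc r) j (<-trans j<r r<n)) (wave-behind (at c) j (s≤s j<r))

    at-final-last : at final r ≡ 0
    at-final-last = trans (at-profile (suc r) r r<n) (wave-last (at c) r)

    at-final-front : suc r < n → at final (suc r) ≡ suc (at c (suc r))
    at-final-front r+1<n = trans (at-profile (suc r) (suc r) r+1<n) (wave-front (at c) (suc r))

    at-final-ahead : ∀ j → suc r < j → j < n → at final j ≡ at c j
    at-final-ahead j r+1<j j<n = trans (at-profile (suc r) j j<n) (wave-ahead (at c) j r+1<j)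

    final-stable : Stable n c → (suc r < n → at c (suc r) < pathDeg n (suc r)) → Stable n final
    final-stable c-stable front-unsaturated = ≤pathDeg⇒stable n final bounded
      where
      bounded : ∀ j → j < n → at final j ≤ pathDeg n j
      bounded j j<n with <-cmp j r
      ... | tri< j<r _ _ rewrite at-final-behind j j<r = pathDeg-notLast n j (≤-<-trans j<r r<n)
      ... | tri≈ _ refl _ rewrite at-final-last = z≤n
      ... | tri> _ _ r<j with m≤n⇒m<n∨m≡n r<j
      ...   | inj₂ refl rewrite at-final-front j<n = front-unsaturated j<n
      ...   | inj₁ r+1<j rewrite at-final-ahead j r+1<j j<n = stable⇒≤pathDeg n c c-stable j j<n

    transition : Stable n c → (suc r < n → at c (suc r) < pathDeg n (suc r)) → Transition n c final
    transition c-stable front-unsaturated = Transition.trans c final (fromℕ< 0<n) c-stable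
      (subst (λ x → Star (ToppleStep n) x final) (sym start) (toppled (suc r) ≤-refl) ,
       final-stable c-stable front-unsaturated)

module Recurrence where

  open Fan
  open Configuration
  open ForbiddenInterval
  open Stability

  private
    <ᵇ-true : ∀ {m n} → m < n → (m <ᵇ n) ≡ true
    <ᵇ-true {m} {n} m<n = Equivalence.to T-≡ (<⇒<ᵇ m<n)

    <ᵇ-false : ∀ {m n} → n ≤ m → (m <ᵇ n) ≡ false
    <ᵇ-false {m} {n} n≤m with m <ᵇ n in eq
    ... | false = refl
    ... | true  = ⊥-elim (<⇒≱ (<ᵇ⇒< m n (subst T (sym eq) tt)) n≤m)

  -- Every stable configuration without forbidden interval is reached from maxStable n, by
  -- downward induction on the length m of a prefix of c without empty vertices.
  module _ (n : ℕ) where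

    ReachedFromMax : ℕ → Set
    ReachedFromMax m = ∀ c → Stable n c → NoForbiddenInterval c → (∀ j → j < m → 1 ≤ at c j) → Reach n (maxStable n) c

    -- An avalanche through the whole path leaves 1 … 1 0.
    reachedFromMax-long : ∀ m → 1 ≤ n → n ≤ suc m → ReachedFromMax m
    reachedFromMax-long m 1≤n n≤m+1 c c-stable _ c-positive =
      transition (maxStable-stable n) (λ r+1<n → ⊥-elim (<-irrefl r+1≡n r+1<n)) ◅ reach-≤ᶜ n final≤c c-stable
      where
      r = n ∸ 1
      r+1≡n : suc r ≡ n
      r+1≡n = m+[n∸m]≡n 1≤n
      r<n : r < n
      r<n = subst (r <_) r+1≡n (n<1+n r)
      open Avalanche.Run (maxStable n) r r<n (λ j j≤r → at-maxStable n j (≤-<-trans j≤r r<n))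
      final≤c : final ≤ᶜ c
      final≤c j with <-cmp j r
      ... | tri< j<r _ _ rewrite at-final-behind j j<r = c-positive j (<-≤-trans j<r (s≤s⁻¹ (subst (_≤ suc m) (sym r+1≡n) n≤m+1)))
      ... | tri≈ _ refl _ rewrite at-final-last = z≤n
      ... | tri> _ _ r<j rewrite at-outside final j (subst (_≤ j) r+1≡n r<j) = z≤n

    -- If c_m = 0, saturate 0, …, m and move one grain of c_{m+1} to the grain added at 0:
    -- the avalanche through 0, …, m then returns below c.
    module Unsaturate (m : ℕ) (m+1<n : suc m < n) (c : Vec ℕ n) (c-stable : Stable n c)
                      (noF : NoForbiddenInterval c) (c-positive : ∀ j → j < m → 1 ≤ at c j) (cm≡0 : at c m ≡ 0) where

      private
        m<n = <-trans (n<1+n m) m+1<n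

        cm+1≥1 : 1 ≤ at c (suc m)
        cm+1≥1 with noF m (suc m) (n<1+n m) m+1<n
        ... | inj₁ cm≥1 = ⊥-elim (<-irrefl (sym cm≡0) cm≥1)
        ... | inj₂ (inj₁ cm+1≥1) = cm+1≥1
        ... | inj₂ (inj₂ (i , m<i , i<m+1 , _)) = ⊥-elim (<-irrefl refl (<-≤-trans m<i (s≤s⁻¹ i<m+1)))

      entry : ℕ → ℕ
      entry j = if j <ᵇ suc m then pathDeg n j else if j ≡ᵇ suc m then at c j ∸ 1 else at c j

      prepared : Vec ℕ n
      prepared = build n entry

      private
        entry-saturated : ∀ j → j ≤ m → entry j ≡ pathDeg n j
        entry-saturated j j≤m rewrite <ᵇ-true (s≤s j≤m) = refl

        entry-front : entry (suc m) ≡ at c (suc m) ∸ 1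
        entry-front rewrite <ᵇ-false {suc m} (≤-refl {suc m}) | ≡ᵇ-true (refl {x = suc m}) = refl

        entry-ahead : ∀ j → suc m < j → entry j ≡ at c j
        entry-ahead j m+1<j rewrite <ᵇ-false (<⇒≤ m+1<j) | ≡ᵇ-false (λ j≡m+1 → <-irrefl (sym j≡m+1) m+1<j) = refl

        at-prepared : ∀ j → j < n → at prepared j ≡ entry j
        at-prepared = at-build n entry

      prepared-stable : Stable n prepared
      prepared-stable = ≤pathDeg⇒stable n prepared bounded
        where
        bounded : ∀ j → j < n → at prepared j ≤ pathDeg n j
        bounded j j<n rewrite at-prepared j j<n with <-cmp j (suc m)
        ... | tri< j<m+1 _ _ rewrite entry-saturated j (s≤s⁻¹ j<m+1) = ≤-refl
        ... | tri≈ _ refl _ rewrite entry-front = ≤-trans (m∸n≤m (at c (suc m)) 1) (stable⇒≤pathDeg n c c-stable (suc m) m+1<n)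
        ... | tri> _ _ m+1<j rewrite entry-ahead j m+1<j = stable⇒≤pathDeg n c c-stable j j<n

      prepared-noForbidden : NoForbiddenInterval prepared
      prepared-noForbidden l r l<r r<n with <-cmp l (suc m)
      ... | tri< l<m+1 _ _ = inj₁ (subst (1 ≤_) (sym (trans (at-prepared l (<-trans l<r r<n)) (entry-saturated l (s≤s⁻¹ l<m+1))))
                                          (pathDeg-notLast n l (≤-<-trans l<r r<n)))
      ... | tri> _ _ m+1<l = allowed-mono-on c prepared l<r
              (λ j l≤j j≤r → ≤-reflexive (sym (trans (at-prepared j (≤-<-trans j≤r r<n)) (entry-ahead j (<-≤-trans m+1<l l≤j)))))
              (noF l r l<r r<n)
      ... | tri≈ _ refl _ with noF m r (<-trans (n<1+n m) l<r) r<n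
      ...   | inj₁ cm≥1 = ⊥-elim (<-irrefl (sym cm≡0) cm≥1)
      ...   | inj₂ (inj₁ cr≥1) = inj₂ (inj₁ (subst (1 ≤_) (sym (trans (at-prepared r r<n) (entry-ahead r l<r))) cr≥1))
      ...   | inj₂ (inj₂ (i , m<i , i<r , ci≥2)) with m≤n⇒m<n∨m≡n m<i
      ...     | inj₂ refl = inj₁ (subst (1 ≤_) (sym (trans (at-prepared (suc m) m+1<n) entry-front)) (∸-monoˡ-≤ 1 ci≥2))
      ...     | inj₁ m+1<i = inj₂ (inj₂ (i , m+1<i , i<r , subst (2 ≤_) (sym (trans (at-prepared i (<-trans i<r r<n)) (entry-ahead i m+1<i))) ci≥2))

      prepared-positive : ∀ j → j < suc m → 1 ≤ at prepared j
      prepared-positive j j<m+1 = subst (1 ≤_) (sym (trans (at-prepared j (<-trans j<m+1 m+1<n)) (entry-saturated j (s≤s⁻¹ j<m+1))))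
                                        (pathDeg-notLast n j (≤-<-trans j<m+1 m+1<n))

      open Avalanche.Run prepared m m<n (λ j j≤m → trans (at-prepared j (≤-<-trans j≤m m<n)) (entry-saturated j j≤m))

      final≤c : final ≤ᶜ c
      final≤c j with <-cmp j m
      ... | tri< j<m _ _ rewrite at-final-behind j j<m = c-positive j j<m
      ... | tri≈ _ refl _ rewrite at-final-last = z≤n
      ... | tri> _ _ m<j with m≤n⇒m<n∨m≡n m<j
      ...   | inj₂ refl rewrite at-final-front m+1<n | at-prepared (suc m) m+1<n | entry-front = ≤-reflexive (m+[n∸m]≡n cm+1≥1)
      ...   | inj₁ m+1<j with j <? n
      ...     | yes j<n rewrite at-final-ahead j m+1<j j<n | at-prepared j j<n | entry-ahead j m+1<j = ≤-refl
      ...     | no j≮n rewrite at-outside final j (≮⇒≥ j≮n) = z≤n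

      front-unsaturated : suc m < n → at prepared (suc m) < pathDeg n (suc m)
      front-unsaturated _ = subst (_< pathDeg n (suc m)) (sym (trans (at-prepared (suc m) m+1<n) entry-front))
        (<-≤-trans (∸-monoʳ-< {o = 0} z<s cm+1≥1) (stable⇒≤pathDeg n c c-stable (suc m) m+1<n))

      reach-via-prepared : ReachedFromMax (suc m) → Reach n (maxStable n) c
      reach-via-prepared reached =
        reached prepared prepared-stable prepared-noForbidden prepared-positive
          ◅◅ (transition prepared-stable front-unsaturated ◅ reach-≤ᶜ n final≤c c-stable)

    reachedFromMax-step : ∀ m → suc m < n → ReachedFromMax (suc m) → ReachedFromMax m
    reachedFromMax-step m m+1<n reached c c-stable noF c-positive with 1 ≤? at c m
    ... | yes cm≥1 = reached c c-stable noF λ j j<m+1 → [ c-positive j , (λ { refl → cm≥1 }) ]′ (m≤n⇒m<n∨m≡n (s≤s⁻¹ j<m+1))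
    ... | no cm≱1 = Unsaturate.reach-via-prepared m m+1<n c c-stable noF c-positive (n<1⇒n≡0 (≰⇒> cm≱1)) reached

    reachedFromMax : 1 ≤ n → ∀ k m → n ≤ suc (m + k) → ReachedFromMax m
    reachedFromMax 1≤n zero    m short = reachedFromMax-long m 1≤n (subst (λ x → n ≤ suc x) (+-identityʳ m) short)
    reachedFromMax 1≤n (suc k) m short with suc m <? n
    ... | yes m+1<n = reachedFromMax-step m m+1<n (reachedFromMax 1≤n k (suc m) (subst (λ x → n ≤ suc x) (+-suc m k) short))
    ... | no m+1≮n  = reachedFromMax-long m 1≤n (≮⇒≥ m+1≮n)

  recurrent⇒noForbidden : ∀ n (c : Vec ℕ n) → Recurrent n c → NoForbiddenInterval c
  recurrent⇒noForbidden n c (c-stable , returns) =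
    noForbidden-reach (returns (maxStable n) (reach-maxStable n c c-stable)) (maxStable-noForbidden n)

  noForbidden⇒recurrent : ∀ n → 1 ≤ n → (c : Vec ℕ n) → Stable n c → NoForbiddenInterval c → Recurrent n c
  noForbidden⇒recurrent n 1≤n c c-stable noF = c-stable , λ d c↝d →
    reach-maxStable n d (reach-stable n c-stable c↝d) ◅◅ reachedFromMax n 1≤n n 0 (n≤1+n n) c c-stable noF λ _ ()

-- The word c is read from its last entry to its first.  State safe: no forbidden interval, and
-- every 0 has a 2 somewhere to its left (so a 0 may be prepended); pending: no forbidden
-- interval, but some 0 lacks such a 2; dead: there is a forbidden interval.
module Scan where

  open Configuration using (at)
  open ForbiddenInterval

  data State : Set where
    safe pending dead : State

  read : ℕ → State → State
  read zero          safe    = pending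
  read zero          pending = dead
  read zero          dead    = dead
  read (suc zero)    s       = s
  read (suc (suc _)) dead    = dead
  read (suc (suc _)) _       = safe

  run : ∀ {m} → Vec ℕ m → State
  run []      = safe
  run (x ∷ w) = read x (run w)

  ZerosCovered : ∀ {m} → Vec ℕ m → Set
  ZerosCovered {m} w = ∀ r → r < m → at w r ≡ 0 → ∃ λ i → i < r × 2 ≤ at w i

  private
    noForbidden-∷⁻ : ∀ {m} x (w : Vec ℕ m) → NoForbiddenInterval (x ∷ w) → NoForbiddenInterval w
    noForbidden-∷⁻ x w noF l r l<r r<m with noF (suc l) (suc r) (s≤s l<r) (s≤s r<m)
    ... | inj₁ wl≥1 = inj₁ wl≥1
    ... | inj₂ (inj₁ wr≥1) = inj₂ (inj₁ wr≥1)
    ... | inj₂ (inj₂ (suc i , s≤s l<i , s≤s i<r , wi≥2)) = inj₂ (inj₂ (i , l<i , i<r , wi≥2))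

    noForbidden-0∷⁻ : ∀ {m} (w : Vec ℕ m) → NoForbiddenInterval (0 ∷ w) → ZerosCovered w
    noForbidden-0∷⁻ w noF r r<m wr≡0 with noF 0 (suc r) z<s (s≤s r<m)
    ... | inj₂ (inj₁ wr≥1) = ⊥-elim (<-irrefl (sym wr≡0) wr≥1)
    ... | inj₂ (inj₂ (suc i , _ , s≤s i<r , wi≥2)) = i , i<r , wi≥2

    noForbidden-∷ : ∀ {m} x (w : Vec ℕ m) → NoForbiddenInterval w → (x ≡ 0 → ZerosCovered w) → NoForbiddenInterval (x ∷ w)
    noForbidden-∷ x w noF covered zero (suc r) _ (s≤s r<m) with 1 ≤? x | 1 ≤? at w r
    ... | yes x≥1 | _        = inj₁ x≥1
    ... | no _    | yes wr≥1 = inj₂ (inj₁ wr≥1)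
    ... | no x≱1  | no wr≱1 with covered (n<1⇒n≡0 (≰⇒> x≱1)) r r<m (n<1⇒n≡0 (≰⇒> wr≱1))
    ...   | i , i<r , wi≥2 = inj₂ (inj₂ (suc i , z<s , s≤s i<r , wi≥2))
    noForbidden-∷ x w noF covered (suc l) (suc r) (s≤s l<r) (s≤s r<m) with noF l r l<r r<m
    ... | inj₁ wl≥1 = inj₁ wl≥1
    ... | inj₂ (inj₁ wr≥1) = inj₂ (inj₁ wr≥1)
    ... | inj₂ (inj₂ (i , l<i , i<r , wi≥2)) = inj₂ (inj₂ (suc i , s≤s l<i , s≤s i<r , wi≥2))

    covered-∷ : ∀ {m} x (w : Vec ℕ m) → x ≢ 0 → 2 ≤ x ⊎ ZerosCovered w → ZerosCovered (x ∷ w)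
    covered-∷ x w x≢0 _            zero    _         x≡0  = ⊥-elim (x≢0 x≡0)
    covered-∷ x w x≢0 (inj₁ x≥2)   (suc r) _         _    = 0 , z<s , x≥2
    covered-∷ x w x≢0 (inj₂ cover) (suc r) (s≤s r<m) wr≡0 with cover r r<m wr≡0
    ... | i , i<r , wi≥2 = suc i , s≤s i<r , wi≥2

    covered-∷⁻ : ∀ {m} x (w : Vec ℕ m) → ZerosCovered (x ∷ w) → ¬ 2 ≤ x → ZerosCovered w
    covered-∷⁻ x w cover x≱2 r r<m wr≡0 with cover (suc r) (s≤s r<m) wr≡0
    ... | zero  , _         , x≥2  = ⊥-elim (x≱2 x≥2)
    ... | suc i , s≤s i<r , wi≥2 = i , i<r , wi≥2

    0∷-uncovered : ∀ {m} (w : Vec ℕ m) → ¬ ZerosCovered (0 ∷ w)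
    0∷-uncovered w cover with cover 0 z<s refl
    ... | _ , () , _

  data Meaning {m} (w : Vec ℕ m) : State → Set where
    safe    : NoForbiddenInterval w → ZerosCovered w → Meaning w safe
    pending : NoForbiddenInterval w → ¬ ZerosCovered w → Meaning w pending
    dead    : ¬ NoForbiddenInterval w → Meaning w dead

  meaning : ∀ {m} (w : Vec ℕ m) → Meaning w (run w)
  meaning []      = safe (λ _ _ _ ()) (λ _ ())
  meaning (x ∷ w) = prepend x (meaning w)
    where
    ≥2 : ∀ {y} → 2 ≤ suc (suc y)
    ≥2 = s≤s (s≤s z≤n)
    prepend : ∀ x {s} → Meaning w s → Meaning (x ∷ w) (read x s)
    prepend zero          (safe noF cover)     = pending (noForbidden-∷ 0 w noF λ _ → cover) (0∷-uncovered w)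
    prepend zero          (pending noF ¬cover) = dead (¬cover ∘ noForbidden-0∷⁻ w)
    prepend zero          (dead ¬noF)          = dead (¬noF ∘ noForbidden-∷⁻ 0 w)
    prepend (suc zero)    (safe noF cover)     = safe (noForbidden-∷ 1 w noF λ ()) (covered-∷ 1 w (λ ()) (inj₂ cover))
    prepend (suc zero)    (pending noF ¬cover) = pending (noForbidden-∷ 1 w noF λ ()) (¬cover ∘ λ cover → covered-∷⁻ 1 w cover λ { (s≤s ()) })
    prepend (suc zero)    (dead ¬noF)          = dead (¬noF ∘ noForbidden-∷⁻ 1 w)
    prepend (suc (suc y)) (safe noF _)         = safe (noForbidden-∷ _ w noF λ ()) (covered-∷ _ w (λ ()) (inj₁ ≥2))
    prepend (suc (suc y)) (pending noF _)      = safe (noForbidden-∷ _ w noF λ ()) (covered-∷ _ w (λ ()) (inj₁ ≥2))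
    prepend (suc (suc y)) (dead ¬noF)          = dead (¬noF ∘ noForbidden-∷⁻ _ w)

  noForbidden⇒alive : ∀ {m} (w : Vec ℕ m) → NoForbiddenInterval w → run w ≢ dead
  noForbidden⇒alive w noF run≡dead with run w | meaning w
  ... | dead | dead ¬noF = ¬noF noF

  alive⇒noForbidden : ∀ {m} (w : Vec ℕ m) → run w ≢ dead → NoForbiddenInterval w
  alive⇒noForbidden w alive with run w | meaning w
  ... | safe    | safe noF _    = noF
  ... | pending | pending noF _ = noF
  ... | dead    | dead _        = ⊥-elim (alive refl)

  bonus : ℕ → State → ℕ
  bonus (suc (suc _)) safe = 1
  bonus _             _    = 0

  isSafe : State → ℕ
  isSafe safe = 1
  isSafe _    = 0

  weight : ∀ {m} → Vec ℕ m → ℕ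
  weight []      = 0
  weight (x ∷ w) = bonus x (run w) + weight w

  scanLevel : ∀ {m} → Vec ℕ m → ℕ
  scanLevel w = weight w + isSafe (run w)

  private
    read-dead : ∀ x → read x dead ≡ dead
    read-dead zero          = refl
    read-dead (suc zero)    = refl
    read-dead (suc (suc _)) = refl

    letter-balance : ∀ x s → x ≤ 2 → read x s ≢ dead → x + isSafe s ≡ 1 + bonus x s + isSafe (read x s)
    letter-balance zero          safe    _ _     = refl
    letter-balance zero          pending _ alive = ⊥-elim (alive refl)
    letter-balance (suc zero)    safe    _ _     = refl
    letter-balance (suc zero)    pending _ _     = refl
    letter-balance (suc (suc zero)) safe    _ _  = refl
    letter-balance (suc (suc zero)) pending _ _  = refl
    letter-balance x             dead    _ alive = ⊥-elim (alive (read-dead x))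
    letter-balance (suc (suc (suc _))) _ (s≤s (s≤s ())) _

  sum-scanLevel : ∀ {m} (w : Vec ℕ m) → (∀ j → at w j ≤ 2) → run w ≢ dead → Vec.sum w + 1 ≡ m + scanLevel w
  sum-scanLevel []          _   _     = refl
  sum-scanLevel {suc m} (x ∷ w) ≤2 alive = begin
    x + Vec.sum w + 1                  ≡⟨ +-assoc x (Vec.sum w) 1 ⟩
    x + (Vec.sum w + 1)                ≡⟨ cong (x +_) (sum-scanLevel w (≤2 ∘ suc) (alive ∘ aliveTail)) ⟩
    x + (m + (weight w + isSafe s))    ≡⟨ solve 4 (λ x m a i → x :+ (m :+ (a :+ i)) := m :+ a :+ (x :+ i)) refl x m (weight w) (isSafe s) ⟩
    m + weight w + (x + isSafe s)      ≡⟨ cong (m + weight w +_) (letter-balance x s (≤2 0) alive) ⟩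
    m + weight w + (1 + bonus x s + isSafe (read x s))
      ≡⟨ solve 5 (λ m a b i one → m :+ a :+ (one :+ b :+ i) := one :+ m :+ (b :+ a :+ i)) refl m (weight w) (bonus x s) (isSafe (read x s)) 1 ⟩
    suc m + scanLevel (x ∷ w)          ∎
    where
    open ≡-Reasoning
    open +-*-Solver
    s = run w
    aliveTail : run w ≡ dead → read x (run w) ≡ dead
    aliveTail run≡dead = trans (cong (read x) run≡dead) (read-dead x)

module RecurrentCount where

  open Enumeration
  open KimberlingNumbers
  open Fan
  open Configuration
  open ForbiddenInterval
  open Stability
  open Recurrence
  open Scan
  open import Data.Integer as ℤ using (+_; _⊖_)
  import Data.Integer.Properties as ℤ

  -- The bound pathDeg on the entries for the vertices 2, …, n: at most 2, the last at most 1.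
  Bounded : ∀ {m} → Vec ℕ (suc m) → Set
  Bounded {zero}  (x ∷ []) = x ≤ 1
  Bounded {suc m} (x ∷ w)  = x ≤ 2 × Bounded w

  Words : ∀ {m} → State → ℕ → Vec ℕ (suc m) → Set
  Words s k w = Bounded w × run w ≡ s × weight w ≡ k

  mutual
    safeWords : ∀ m → ℕ → List (Vec ℕ (suc m))
    safeWords zero    zero    = (1 ∷ []) ∷ []
    safeWords zero    (suc k) = []
    safeWords (suc m) k       =
      map (1 ∷_) (safeWords m k) ++ (map (2 ∷_) (shift (safeWords m) k) ++ map (2 ∷_) (pendingWords m k))

    pendingWords : ∀ m → ℕ → List (Vec ℕ (suc m))
    pendingWords zero    zero    = (0 ∷ []) ∷ []
    pendingWords zero    (suc k) = []
    pendingWords (suc m) k       = map (0 ∷_) (safeWords m k) ++ map (1 ∷_) (pendingWords m k)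

  mutual
    length-safeWords : ∀ m k → length (safeWords m k) ≡ kimb (suc m) k
    length-safeWords zero    zero    = refl
    length-safeWords zero    (suc k) = refl
    length-safeWords (suc m) k       = trans (length-map-++ (1 ∷_) (safeWords m k) _)
      (cong₂ _+_ (length-safeWords m k)
                 (trans (length-map-++-map (2 ∷_) (2 ∷_) (shift (safeWords m) k) (pendingWords m k))
                        (cong₂ _+_ (length-shift (safeWords m) (suc m) (length-safeWords m) k) (length-pendingWords m k))))

    length-pendingWords : ∀ m k → length (pendingWords m k) ≡ kimb₀ (suc m) k
    length-pendingWords zero    zero    = refl
    length-pendingWords zero    (suc k) = refl
    length-pendingWords (suc m) k       = trans (length-map-++-map (0 ∷_) (1 ∷_) (safeWords m k) (pendingWords m k))
      (cong₂ _+_ (length-safeWords m k) (length-pendingWords m k))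

  private
    shift-safe : ∀ {m} k (w : Vec ℕ (suc m)) → Shift (Words safe) k w → run w ≡ safe
    shift-safe (suc k) w (_ , run≡safe , _) = run≡safe

    cons-injective : ∀ {m} {P : Vec ℕ m → Set} x {v w} → P v → P w → x ∷ v ≡ x ∷ w → v ≡ w
    cons-injective x _ _ = ∷-injectiveʳ

    safe≢pending : ∀ {m} {v w : Vec ℕ m} → v ≡ w → run v ≡ safe → run w ≡ pending → ⊥
    safe≢pending refl run≡safe run≡pending with trans (sym run≡safe) run≡pending
    ... | ()

  mutual
    enumerates-safeWords : ∀ m k → Enumerates (Words safe k) (safeWords m k)
    enumerates-safeWords zero zero = enumerates-singleton (1 ∷ []) only (s≤s z≤n , refl , refl)
      where
      only : ∀ w → Words safe 0 w → w ≡ 1 ∷ []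
      only (zero ∷ [])          (_ , () , _)
      only (suc zero ∷ [])      _ = refl
      only (suc (suc _) ∷ [])   (s≤s () , _)
    enumerates-safeWords zero (suc k) = enumerates-[] none
      where
      none : ∀ w → ¬ Words safe (suc k) w
      none (zero ∷ [])          (_ , () , _)
      none (suc zero ∷ [])      (_ , _ , ())
      none (suc (suc _) ∷ [])   (s≤s () , _)
    enumerates-safeWords (suc m) k = enumerates-⊎₃
      (enumerates-map (1 ∷_) (cons-injective 1) (enumerates-safeWords m k))
      (enumerates-map (2 ∷_) (cons-injective 2) (enumerates-shift (enumerates-safeWords m) k))
      (enumerates-map (2 ∷_) (cons-injective 2) (enumerates-pendingWords m k))
      (λ { _ (_ , _ , refl) (_ , _ , ()) })
      (λ { _ (_ , _ , refl) (_ , _ , ()) })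
      (λ { _ (v , shifted , refl) (w , (_ , run≡pending , _) , eq) → safe≢pending (∷-injectiveʳ eq) (shift-safe k v shifted) run≡pending })
      split
      (λ { _ (w , (bounded , run≡safe , refl) , refl) → (s≤s z≤n , bounded) , run≡safe , refl })
      (λ { _ (w , shifted , refl) → prepend2 k w shifted })
      (λ { _ (w , (bounded , run≡pending , refl) , refl) →
             (s≤s (s≤s z≤n) , bounded) , cong (read 2) run≡pending , cong (λ s → bonus 2 s + weight w) run≡pending })
      where
      prepend2 : ∀ k w → Shift (Words safe) k w → Words safe k (2 ∷ w)
      prepend2 (suc k) w (bounded , run≡safe , refl) =
        (s≤s (s≤s z≤n) , bounded) , cong (read 2) run≡safe , cong (λ s → bonus 2 s + weight w) run≡safe
      split : ∀ w → Words safe k w → Image (1 ∷_) (Words safe k) w ⊎ (Image (2 ∷_) (Shift (Words safe) k) w ⊎ Image (2 ∷_) (Words pending k) w)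
      split (x ∷ w) ((x≤2 , bounded) , _ , _) with run w in run≡
      split (0 ∷ w)         (_ , () , _) | safe
      split (0 ∷ w)         (_ , () , _) | pending
      split (0 ∷ w)         (_ , () , _) | dead
      split (1 ∷ w)         ((_ , bounded) , _ , weight≡) | safe = inj₁ (w , (bounded , run≡ , weight≡) , refl)
      split (1 ∷ w)         (_ , () , _) | pending
      split (1 ∷ w)         (_ , () , _) | dead
      split (2 ∷ w)         ((_ , bounded) , _ , refl) | safe = inj₂ (inj₁ (w , (bounded , run≡ , refl) , refl))
      split (2 ∷ w)         ((_ , bounded) , _ , weight≡) | pending = inj₂ (inj₂ (w , (bounded , run≡ , weight≡) , refl))
      split (2 ∷ w)         (_ , () , _) | dead
      split (suc (suc (suc _)) ∷ w) ((s≤s (s≤s ()) , _) , _) | _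

    enumerates-pendingWords : ∀ m k → Enumerates (Words pending k) (pendingWords m k)
    enumerates-pendingWords zero zero = enumerates-singleton (0 ∷ []) only (z≤n , refl , refl)
      where
      only : ∀ w → Words pending 0 w → w ≡ 0 ∷ []
      only (zero ∷ [])          _ = refl
      only (suc zero ∷ [])      (_ , () , _)
      only (suc (suc _) ∷ [])   (s≤s () , _)
    enumerates-pendingWords zero (suc k) = enumerates-[] none
      where
      none : ∀ w → ¬ Words pending (suc k) w
      none (zero ∷ [])          (_ , _ , ())
      none (suc zero ∷ [])      (_ , () , _)
      none (suc (suc _) ∷ [])   (s≤s () , _)
    enumerates-pendingWords (suc m) k = enumerates-⊎
      (enumerates-map (0 ∷_) (cons-injective 0) (enumerates-safeWords m k))
      (enumerates-map (1 ∷_) (cons-injective 1) (enumerates-pendingWords m k))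
      (λ { _ (_ , _ , refl) (_ , _ , ()) })
      split
      (λ { _ (w , (bounded , run≡safe , refl) , refl) → (z≤n , bounded) , cong (read 0) run≡safe , refl })
      (λ { _ (w , (bounded , run≡pending , refl) , refl) → (s≤s z≤n , bounded) , cong (read 1) run≡pending , refl })
      where
      split : ∀ w → Words pending k w → Image (0 ∷_) (Words safe k) w ⊎ Image (1 ∷_) (Words pending k) w
      split (x ∷ w) ((x≤2 , bounded) , _ , _) with run w in run≡
      split (0 ∷ w)         ((_ , bounded) , _ , weight≡) | safe = inj₁ (w , (bounded , run≡ , weight≡) , refl)
      split (0 ∷ w)         (_ , () , _) | pending
      split (0 ∷ w)         (_ , () , _) | dead
      split (1 ∷ w)         (_ , () , _) | safe
      split (1 ∷ w)         ((_ , bounded) , _ , weight≡) | pending = inj₂ (w , (bounded , run≡ , weight≡) , refl)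
      split (1 ∷ w)         (_ , () , _) | dead
      split (2 ∷ w)         (_ , () , _) | safe
      split (2 ∷ w)         (_ , () , _) | pending
      split (2 ∷ w)         (_ , () , _) | dead
      split (suc (suc (suc _)) ∷ w) ((s≤s (s≤s ()) , _) , _) | _

  AliveWord : ∀ n → ℕ → Vec ℕ n → Set
  AliveWord zero          k _        = ⊥
  AliveWord (suc zero)    k (x ∷ []) = x ≡ 0 × k ≡ 0
  AliveWord (suc (suc m)) k (x ∷ w)  = x ≤ 1 × Bounded w × read x (run w) ≢ dead × scanLevel (x ∷ w) ≡ k

  recurrentWords : ∀ n → ℕ → List (Vec ℕ n)
  recurrentWords zero          k       = []
  recurrentWords (suc zero)    zero    = (0 ∷ []) ∷ []
  recurrentWords (suc zero)    (suc k) = []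
  recurrentWords (suc (suc m)) k       =
    map (0 ∷_) (safeWords m k) ++ (map (1 ∷_) (shift (safeWords m) k) ++ map (1 ∷_) (pendingWords m k))

  length-recurrentWords : ∀ n k → length (recurrentWords (suc n) k) ≡ kimb (suc n) k
  length-recurrentWords zero    zero    = refl
  length-recurrentWords zero    (suc k) = refl
  length-recurrentWords (suc m) k       = trans (length-map-++ (0 ∷_) (safeWords m k) _)
    (cong₂ _+_ (length-safeWords m k)
               (trans (length-map-++-map (1 ∷_) (1 ∷_) (shift (safeWords m) k) (pendingWords m k))
                      (cong₂ _+_ (length-shift (safeWords m) (suc m) (length-safeWords m) k) (length-pendingWords m k))))

  enumerates-recurrentWords : ∀ n k → Enumerates (AliveWord (suc n) k) (recurrentWords (suc n) k)
  enumerates-recurrentWords zero zero = enumerates-singleton (0 ∷ []) (λ { (x ∷ []) (refl , _) → refl }) (refl , refl)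
  enumerates-recurrentWords zero (suc k) = enumerates-[] λ { (x ∷ []) (_ , ()) }
  enumerates-recurrentWords (suc m) k = enumerates-⊎₃
    (enumerates-map (0 ∷_) (cons-injective 0) (enumerates-safeWords m k))
    (enumerates-map (1 ∷_) (cons-injective 1) (enumerates-shift (enumerates-safeWords m) k))
    (enumerates-map (1 ∷_) (cons-injective 1) (enumerates-pendingWords m k))
    (λ { _ (_ , _ , refl) (_ , _ , ()) })
    (λ { _ (_ , _ , refl) (_ , _ , ()) })
    (λ { _ (v , shifted , refl) (w , (_ , run≡pending , _) , eq) → safe≢pending (∷-injectiveʳ eq) (shift-safe k v shifted) run≡pending })
    split
    (λ { _ (w , words , refl) → prepend0 w words })
    (λ { _ (w , shifted , refl) → prepend1 k w shifted })
    (λ { _ (w , words , refl) → prepend1′ w words })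
    where
    prepend0 : ∀ w → Words safe k w → AliveWord (suc (suc m)) k (0 ∷ w)
    prepend0 w (bounded , run≡safe , refl) rewrite run≡safe = z≤n , bounded , (λ ()) , +-identityʳ (weight w)

    prepend1 : ∀ k w → Shift (Words safe) k w → AliveWord (suc (suc m)) k (1 ∷ w)
    prepend1 (suc k) w (bounded , run≡safe , refl) rewrite run≡safe = s≤s z≤n , bounded , (λ ()) , +-comm (weight w) 1

    prepend1′ : ∀ w → Words pending k w → AliveWord (suc (suc m)) k (1 ∷ w)
    prepend1′ w (bounded , run≡pending , refl) rewrite run≡pending = s≤s z≤n , bounded , (λ ()) , +-identityʳ (weight w)

    split : ∀ c → AliveWord (suc (suc m)) k c →
            Image (0 ∷_) (Words safe k) c ⊎ (Image (1 ∷_) (Shift (Words safe) k) c ⊎ Image (1 ∷_) (Words pending k) c)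
    split (x ∷ w) (x≤1 , bounded , alive , level≡) with run w in run≡
    split (0 ∷ w) (_ , bounded , _ , level≡) | safe = inj₁ (w , (bounded , run≡ , trans (sym (+-identityʳ (weight w))) level≡) , refl)
    split (0 ∷ w) (_ , _ , alive , _) | pending = ⊥-elim (alive refl)
    split (0 ∷ w) (_ , _ , alive , _) | dead = ⊥-elim (alive refl)
    split (1 ∷ w) (_ , bounded , _ , refl) | safe =
      inj₂ (inj₁ (w , subst (λ k → Shift (Words safe) k w) (+-comm 1 (weight w)) (bounded , run≡ , refl) , refl))
    split (1 ∷ w) (_ , bounded , _ , level≡) | pending = inj₂ (inj₂ (w , (bounded , run≡ , trans (sym (+-identityʳ (weight w))) level≡) , refl))
    split (1 ∷ w) (_ , _ , alive , _) | dead = ⊥-elim (alive refl)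
    split (suc (suc _) ∷ w) (s≤s () , _) | _

  private
    ⊖≡+⇒ : ∀ {m n k} → m ⊖ n ≡ + k → m ≡ n + k
    ⊖≡+⇒ {m} {n} m⊖n≡k with n ≤? m
    ... | yes n≤m = trans (sym (m+[n∸m]≡n n≤m)) (cong (λ x → n + x) (ℤ.+-injective (trans (sym (ℤ.⊖-≥ n≤m)) m⊖n≡k)))
    ... | no n≰m = ⊥-elim (negative (n ∸ m) (m<n⇒0<n∸m (≰⇒> n≰m)) (trans (sym (ℤ.⊖-< (≰⇒> n≰m))) m⊖n≡k))
      where
      negative : ∀ a {k} → 0 < a → ℤ.- (+ a) ≢ + k
      negative (suc a) _ ()

    ⊖≡+⇐ : ∀ {m n k} → m ≡ n + k → m ⊖ n ≡ + k
    ⊖≡+⇐ {n = n} {k} refl = trans (ℤ.⊖-≥ (m≤m+n n k)) (cong +_ (m+n∸m≡n n k))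

    level-suc : ∀ n (c : Vec ℕ (suc n)) → level (suc n) c ≡ Vec.sum c ⊖ n
    level-suc n c = begin
      (+ Vec.sum c ℤ.+ + deg (suc n) 0) ℤ.- + length (fanEdges (suc n))
        ≡⟨ cong₂ (λ d e → (+ Vec.sum c ℤ.+ + d) ℤ.- + e) (deg-sink (suc n)) (length-fanEdges (suc n)) ⟩
      (+ Vec.sum c ℤ.+ + suc n) ℤ.- + (n + suc n)   ≡⟨ cong (ℤ._- + (n + suc n)) (sym (ℤ.pos-+ (Vec.sum c) (suc n))) ⟩
      + (Vec.sum c + suc n) ℤ.- + (n + suc n)       ≡⟨ ℤ.[+m]-[+n]≡m⊖n (Vec.sum c + suc n) (n + suc n) ⟩
      (Vec.sum c + suc n) ⊖ (n + suc n)             ≡⟨ cong₂ _⊖_ (+-comm (Vec.sum c) (suc n)) (+-comm n (suc n)) ⟩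
      (suc n + Vec.sum c) ⊖ (suc n + n)             ≡⟨ ℤ.+-cancelˡ-⊖ (suc n) (Vec.sum c) n ⟩
      Vec.sum c ⊖ n                                 ∎
      where open ≡-Reasoning

    stable⇒≤2 : ∀ n (c : Vec ℕ n) → Stable n c → ∀ j → at c j ≤ 2
    stable⇒≤2 n c stable j = ≤-trans (stable⇒≤maxStable n c stable j) (maxStable≤2 j)
      where
      maxStable≤2 : ∀ j → at (maxStable n) j ≤ 2
      maxStable≤2 j with j <? n
      ... | yes j<n = subst (_≤ 2) (sym (at-maxStable n j j<n)) (pathDeg≤2 n j)
      ... | no j≮n  = subst (_≤ 2) (sym (at-outside (maxStable n) j (≮⇒≥ j≮n))) z≤n

  Scanned : ∀ n → ℕ → Vec ℕ n → Set
  Scanned n k c = Stable n c × run c ≢ dead × scanLevel c ≡ k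

  recurrentOfLevel⇔scanned : ∀ n k (c : Vec ℕ (suc n)) → RecurrentOfLevel (suc n) k c ⇔ Scanned (suc n) k c
  recurrentOfLevel⇔scanned n k c = mk⇔
    (λ (recurrent , level≡k) → let stable = proj₁ recurrent ; alive = noForbidden⇒alive c (recurrent⇒noForbidden (suc n) c recurrent) in
       stable , alive , +-cancelˡ-≡ n _ _ (trans (sym (sum≡ stable alive)) (⊖≡+⇒ (trans (sym (level-suc n c)) level≡k))))
    (λ { (stable , alive , refl) →
       noForbidden⇒recurrent (suc n) (s≤s z≤n) c stable (alive⇒noForbidden c alive) ,
       trans (level-suc n c) (⊖≡+⇐ {n = n} (sum≡ stable alive)) })
    where
    sum≡ : Stable (suc n) c → run c ≢ dead → Vec.sum c ≡ n + scanLevel c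
    sum≡ stable alive = suc-injective (trans (+-comm 1 (Vec.sum c)) (sum-scanLevel c (stable⇒≤2 (suc n) c stable) alive))

  private
    bounded⇒ : ∀ {m} (w : Vec ℕ (suc m)) → Bounded w → ∀ j → j < suc m → at w j ≤ pathDeg (suc (suc m)) (suc j)
    bounded⇒ {zero}  (x ∷ []) x≤1 zero    _ = x≤1
    bounded⇒ {zero}  (x ∷ []) _   (suc j) (s≤s ())
    bounded⇒ {suc m} (x ∷ w) (x≤2 , _)       zero    _ = x≤2
    bounded⇒ {suc m} (x ∷ w) (_ , bounded)   (suc j) (s≤s j<m+1) = bounded⇒ w bounded j j<m+1

    ⇒bounded : ∀ {m} (w : Vec ℕ (suc m)) → (∀ j → j < suc m → at w j ≤ pathDeg (suc (suc m)) (suc j)) → Bounded w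
    ⇒bounded {zero}  (x ∷ []) bound = bound 0 z<s
    ⇒bounded {suc m} (x ∷ w)  bound = bound 0 z<s , ⇒bounded w λ j j<m+1 → bound (suc j) (s≤s j<m+1)

  scanned⇔aliveWord : ∀ n k (c : Vec ℕ (suc n)) → Scanned (suc n) k c ⇔ AliveWord (suc n) k c
  scanned⇔aliveWord zero k (x ∷ []) = mk⇔
    (λ (stable , _ , level≡k) → case≡0 (stable⇒≤pathDeg 1 (x ∷ []) stable 0 z<s) level≡k)
    (λ { (refl , refl) → ≤pathDeg⇒stable 1 (0 ∷ []) (λ { zero _ → z≤n ; (suc j) (s≤s ()) }) , (λ ()) , refl })
    where
    case≡0 : x ≤ 0 → scanLevel (x ∷ []) ≡ k → x ≡ 0 × k ≡ 0
    case≡0 z≤n refl = refl , refl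
  scanned⇔aliveWord (suc m) k (x ∷ w) = mk⇔
    (λ (stable , alive , level≡k) → stable⇒≤pathDeg _ (x ∷ w) stable 0 z<s ,
       ⇒bounded w (λ j j<m+1 → stable⇒≤pathDeg _ (x ∷ w) stable (suc j) (s≤s j<m+1)) , alive , level≡k)
    (λ (x≤1 , bounded , alive , level≡k) →
       ≤pathDeg⇒stable _ (x ∷ w) (λ { zero _ → x≤1 ; (suc j) (s≤s j<m+1) → bounded⇒ w bounded j j<m+1 }) ,
       alive , level≡k)

  recurrentOfLevel-hasCard : ∀ n k → HasCard (RecurrentOfLevel (suc n) k) (kimb (suc n) k)
  recurrentOfLevel-hasCard n k = subst (HasCard (RecurrentOfLevel (suc n) k)) (length-recurrentWords n k)
    (hasCard (enumerates-⇔ (λ c → Equivalence.from (recurrentOfLevel⇔scanned n k c) ∘ Equivalence.from (scanned⇔aliveWord n k c))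
                           (λ c → Equivalence.to (scanned⇔aliveWord n k c) ∘ Equivalence.to (recurrentOfLevel⇔scanned n k c))
                           (enumerates-recurrentWords n k)))

module KimberlingCount where

  open Enumeration
  open KimberlingNumbers
  open import Data.Nat.ListAction using (sum)

  Path : Set
  Path = List (ℕ × ℕ)

  width height : Path → ℕ
  width  ℓ = sum (map proj₁ ℓ)
  height ℓ = sum (map proj₂ ℓ)

  Steps : Path → Set
  Steps = All λ s → 1 ≤ proj₁ s

  NonEmpty : Path → Set
  NonEmpty []      = ⊥
  NonEmpty (_ ∷ _) = ⊤

  FlatStart : Path → Set
  FlatStart []            = ⊤
  FlatStart ((_ , b) ∷ _) = b ≡ 0

  Kimb Kimb₀ : ℕ → ℕ → Path → Set
  Kimb  n k ℓ = Steps ℓ × width ℓ + height ℓ ≡ n × height ℓ ≡ k × NonEmpty ℓ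
  Kimb₀ n k ℓ = Steps ℓ × width ℓ + height ℓ ≡ n × height ℓ ≡ k × FlatStart ℓ

  unitStep : Path → Path
  unitStep ℓ = (1 , 0) ∷ ℓ

  raiseFirst : Path → Path
  raiseFirst []            = []
  raiseFirst ((a , b) ∷ ℓ) = (a , suc b) ∷ ℓ

  widenFirst : Path → Path
  widenFirst []            = (1 , 0) ∷ []
  widenFirst ((a , b) ∷ ℓ) = (suc a , b) ∷ ℓ

  mutual
    kimbPaths : ℕ → ℕ → List Path
    kimbPaths zero    k = []
    kimbPaths (suc n) k = map unitStep (kimbPaths n k) ++ (map raiseFirst (shift (kimbPaths n) k) ++ map widenFirst (kimb₀Paths n k))

    kimb₀Paths : ℕ → ℕ → List Path
    kimb₀Paths zero    zero    = [] ∷ []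
    kimb₀Paths zero    (suc k) = []
    kimb₀Paths (suc n) k       = map unitStep (kimbPaths n k) ++ map widenFirst (kimb₀Paths n k)

  mutual
    length-kimbPaths : ∀ n k → length (kimbPaths n k) ≡ kimb n k
    length-kimbPaths zero    k = refl
    length-kimbPaths (suc n) k = trans (length-map-++ unitStep (kimbPaths n k) _)
      (cong₂ _+_ (length-kimbPaths n k)
                 (trans (length-map-++-map raiseFirst widenFirst (shift (kimbPaths n) k) (kimb₀Paths n k))
                        (cong₂ _+_ (length-shift (kimbPaths n) n (length-kimbPaths n) k) (length-kimb₀Paths n k))))

    length-kimb₀Paths : ∀ n k → length (kimb₀Paths n k) ≡ kimb₀ n k
    length-kimb₀Paths zero    zero    = refl
    length-kimb₀Paths zero    (suc k) = refl
    length-kimb₀Paths (suc n) k       = trans (length-map-++-map unitStep widenFirst (kimbPaths n k) (kimb₀Paths n k))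
      (cong₂ _+_ (length-kimbPaths n k) (length-kimb₀Paths n k))

  private
    unitStep-injective : ∀ {P : Path → Set} {ℓ ℓ′} → P ℓ → P ℓ′ → unitStep ℓ ≡ unitStep ℓ′ → ℓ ≡ ℓ′
    unitStep-injective _ _ refl = refl

    raiseFirst-injective : ∀ {P : Path → Set} {ℓ ℓ′} → P ℓ → P ℓ′ → raiseFirst ℓ ≡ raiseFirst ℓ′ → ℓ ≡ ℓ′
    raiseFirst-injective {ℓ = []}    {[]}    _ _ _    = refl
    raiseFirst-injective {ℓ = _ ∷ _} {_ ∷ _} _ _ refl = refl

    widenFirst-injective : ∀ {n k ℓ ℓ′} → Kimb₀ n k ℓ → Kimb₀ n k ℓ′ → widenFirst ℓ ≡ widenFirst ℓ′ → ℓ ≡ ℓ′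
    widenFirst-injective {ℓ = []}          {[]}           _          _          _    = refl
    widenFirst-injective {ℓ = []}          {(0 , _) ∷ _} _          (() ∷ _ , _) _
    widenFirst-injective {ℓ = (0 , _) ∷ _} {[]}          (() ∷ _ , _) _          _
    widenFirst-injective {ℓ = _ ∷ _}       {_ ∷ _}       _          _          refl = refl

    unitStep≢widenFirst : ∀ {n k} ℓ ℓ′ → Kimb n k ℓ → Kimb₀ n k ℓ′ → unitStep ℓ ≢ widenFirst ℓ′
    unitStep≢widenFirst []      _               (_ , _ , _ , ()) _
    unitStep≢widenFirst (_ ∷ _) []              _ _ ()
    unitStep≢widenFirst _       ((0 , _) ∷ _)  _ (() ∷ _ , _) _

    unitStep≢raiseFirst : ∀ {n} k ℓ ℓ′ → Kimb n k ℓ → Shift (Kimb n) k ℓ′ → unitStep ℓ ≢ raiseFirst ℓ′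
    unitStep≢raiseFirst (suc k) ℓ []      _ (_ , _ , _ , ()) _
    unitStep≢raiseFirst (suc k) ℓ (_ ∷ _) _ _ ()

    raiseFirst≢widenFirst : ∀ {n} k ℓ ℓ′ → Shift (Kimb n) k ℓ → Kimb₀ n k ℓ′ → raiseFirst ℓ ≢ widenFirst ℓ′
    raiseFirst≢widenFirst (suc k) []      _       (_ , _ , _ , ()) _
    raiseFirst≢widenFirst (suc k) (_ ∷ _) []              _ _ ()
    raiseFirst≢widenFirst (suc k) (_ ∷ _) (_ ∷ _) _ (_ , _ , _ , ()) refl

    unitStep-kimb₀ : ∀ {n k} ℓ → Kimb n k ℓ → Kimb₀ (suc n) k (unitStep ℓ)
    unitStep-kimb₀ ℓ (steps , size , refl , _) = s≤s z≤n ∷ steps , cong suc size , refl , refl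

    widenFirst-kimb₀ : ∀ {n k} ℓ → Kimb₀ n k ℓ → Kimb₀ (suc n) k (widenFirst ℓ)
    widenFirst-kimb₀ []            (_ , size , refl , _)          = s≤s z≤n ∷ [] , cong suc size , refl , refl
    widenFirst-kimb₀ ((a , b) ∷ ℓ) (_ ∷ steps , size , refl , flat) = s≤s z≤n ∷ steps , cong suc size , refl , flat

    raiseFirst-kimb : ∀ {n} k ℓ → Shift (Kimb n) k ℓ → Kimb (suc n) k (raiseFirst ℓ)
    raiseFirst-kimb (suc k) ((a , b) ∷ ℓ) (a≥1 ∷ steps , size , refl , _) =
      a≥1 ∷ steps , trans (+-suc (a + width ℓ) (b + height ℓ)) (cong suc size) , refl , tt

    kimb₀⇒kimb : ∀ {n k} ℓ → Kimb₀ (suc n) k ℓ → Kimb (suc n) k ℓ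
    kimb₀⇒kimb []      (_ , () , _)
    kimb₀⇒kimb (_ ∷ _) (steps , size , height≡ , _) = steps , size , height≡ , tt

    splitFlat : ∀ n k a ℓ → Kimb₀ (suc n) k ((a , 0) ∷ ℓ) →
                Image unitStep (Kimb n k) ((a , 0) ∷ ℓ) ⊎ Image widenFirst (Kimb₀ n k) ((a , 0) ∷ ℓ)
    splitFlat n k 1 []      (_ ∷ steps , size , height≡ , _) = inj₂ ([] , (steps , suc-injective size , height≡ , tt) , refl)
    splitFlat n k 1 (s ∷ ℓ) (_ ∷ steps , size , height≡ , _) = inj₁ (s ∷ ℓ , (steps , suc-injective size , height≡ , tt) , refl)
    splitFlat n k (suc (suc a)) ℓ (_ ∷ steps , size , height≡ , _) =
      inj₂ ((suc a , 0) ∷ ℓ , (s≤s z≤n ∷ steps , suc-injective size , height≡ , refl) , refl)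

  mutual
    enumerates-kimbPaths : ∀ n k → Enumerates (Kimb n k) (kimbPaths n k)
    enumerates-kimbPaths zero k = enumerates-[] none
      where
      none : ∀ ℓ → ¬ Kimb 0 k ℓ
      none []            (_ , _ , _ , ())
      none ((0 , _) ∷ _) (() ∷ _ , _)
    enumerates-kimbPaths (suc n) k = enumerates-⊎₃
      (enumerates-map unitStep unitStep-injective (enumerates-kimbPaths n k))
      (enumerates-map raiseFirst raiseFirst-injective (enumerates-shift (enumerates-kimbPaths n) k))
      (enumerates-map widenFirst widenFirst-injective (enumerates-kimb₀Paths n k))
      (λ { _ (ℓ , P , refl) (ℓ′ , Q , e) → unitStep≢raiseFirst k ℓ ℓ′ P Q e })
      (λ { _ (ℓ , P , refl) (ℓ′ , Q , e) → unitStep≢widenFirst ℓ ℓ′ P Q e })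
      (λ { _ (ℓ , P , refl) (ℓ′ , Q , e) → raiseFirst≢widenFirst k ℓ ℓ′ P Q e })
      split
      (λ { _ (ℓ , P , refl) → kimb₀⇒kimb _ (unitStep-kimb₀ ℓ P) })
      (λ { _ (ℓ , P , refl) → raiseFirst-kimb k ℓ P })
      (λ { _ (ℓ , P , refl) → kimb₀⇒kimb _ (widenFirst-kimb₀ ℓ P) })
      where
      split : ∀ ℓ → Kimb (suc n) k ℓ → Image unitStep (Kimb n k) ℓ ⊎ (Image raiseFirst (Shift (Kimb n) k) ℓ ⊎ Image widenFirst (Kimb₀ n k) ℓ)
      split [] (_ , _ , _ , ())
      split ((a , suc b) ∷ ℓ) (a≥1 ∷ steps , size , refl , _) =
        inj₂ (inj₁ ((a , b) ∷ ℓ , (a≥1 ∷ steps , suc-injective (trans (sym (+-suc (a + width ℓ) (b + height ℓ))) size) , refl , tt) , refl))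
      split ((a , zero) ∷ ℓ) (steps , size , height≡ , _) with splitFlat n k a ℓ (steps , size , height≡ , refl)
      ... | inj₁ unit = inj₁ unit
      ... | inj₂ widened = inj₂ (inj₂ widened)

    enumerates-kimb₀Paths : ∀ n k → Enumerates (Kimb₀ n k) (kimb₀Paths n k)
    enumerates-kimb₀Paths zero zero = enumerates-singleton [] only ([] , refl , refl , tt)
      where
      only : ∀ ℓ → Kimb₀ 0 0 ℓ → ℓ ≡ []
      only []            _ = refl
      only ((0 , _) ∷ _) (() ∷ _ , _)
    enumerates-kimb₀Paths zero (suc k) = enumerates-[] none
      where
      none : ∀ ℓ → ¬ Kimb₀ 0 (suc k) ℓ
      none []            (_ , _ , () , _)
      none ((0 , _) ∷ _) (() ∷ _ , _)
    enumerates-kimb₀Paths (suc n) k = enumerates-⊎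
      (enumerates-map unitStep unitStep-injective (enumerates-kimbPaths n k))
      (enumerates-map widenFirst widenFirst-injective (enumerates-kimb₀Paths n k))
      (λ { _ (ℓ , P , refl) (ℓ′ , Q , e) → unitStep≢widenFirst ℓ ℓ′ P Q e })
      split
      (λ { _ (ℓ , P , refl) → unitStep-kimb₀ ℓ P })
      (λ { _ (ℓ , P , refl) → widenFirst-kimb₀ ℓ P })
      where
      split : ∀ ℓ → Kimb₀ (suc n) k ℓ → Image unitStep (Kimb n k) ℓ ⊎ Image widenFirst (Kimb₀ n k) ℓ
      split []               (_ , () , _)
      split ((a , .0) ∷ ℓ) P@(_ , _ , _ , refl) = splitFlat n k a ℓ P

  kimbPath⇔kimb : ∀ n k → k < n → ∀ ℓ → KimbPath (n ∸ k) k ℓ ⇔ Kimb n k ℓ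
  kimbPath⇔kimb n k k<n ℓ = mk⇔
    (λ (steps , width≡ , height≡) → steps , trans (cong₂ _+_ width≡ height≡) (m∸n+n≡m (<⇒≤ k<n)) , height≡ , nonEmpty ℓ width≡)
    (λ (steps , size , height≡ , _) → steps , trans (sym (m+n∸n≡m (width ℓ) (height ℓ))) (cong₂ _∸_ size height≡) , height≡)
    where
    nonEmpty : ∀ ℓ → width ℓ ≡ n ∸ k → NonEmpty ℓ
    nonEmpty []      0≡n-k = <-irrefl 0≡n-k (m<n⇒0<n∸m k<n)
    nonEmpty (_ ∷ _) _     = tt

  kimbPath-hasCard : ∀ n k → k < n → HasCard (KimbPath (n ∸ k) k) (kimb n k)
  kimbPath-hasCard n k k<n = subst (HasCard (KimbPath (n ∸ k) k)) (length-kimbPaths n k)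
    (hasCard (enumerates-⇔ (λ ℓ → Equivalence.from (kimbPath⇔kimb n k k<n ℓ)) (λ ℓ → Equivalence.to (kimbPath⇔kimb n k k<n ℓ))
                           (enumerates-kimbPaths n k)))

module BoolVec where

  -- Entry j of a Boolean vector, with the junk value false for j ≥ n.
  has : ∀ {n} → Vec Bool n → ℕ → Bool
  has []      _       = false
  has (b ∷ v) zero    = b
  has (b ∷ v) (suc j) = has v j

  has⇒< : ∀ {n} (v : Vec Bool n) j → T (has v j) → j < n
  has⇒< (b ∷ v) zero    _       = z<s
  has⇒< (b ∷ v) (suc j) present = s≤s (has⇒< v j present)

  bit : Bool → ℕ
  bit true  = 1
  bit false = 0

  ones : ∀ {n} → Vec Bool n → ℕ
  ones []      = 0
  ones (b ∷ v) = bit b + ones v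

module SubgraphCount where

  open Enumeration
  open KimberlingNumbers
  open BoolVec
  import Data.Fin.Subset as Subset
  open +-*-Solver

  -- A subgraph of P_{m+1}: vertex j + 1 is in V iff has V j, edge {j + 1, j + 2} in E iff has E j.
  Subgraph : ℕ → Set
  Subgraph m = Vec Bool (suc m) × Vec Bool m

  EdgesSupported : ∀ {m} → Subgraph m → Set
  EdgesSupported (V , E) = ∀ e → T (has E e) → T (has V e) × T (has V (suc e))

  WithLast : ∀ m → ℕ → Subgraph m → Set
  WithLast m k (V , E) = EdgesSupported (V , E) × T (has V m) × Subset.∣ E ∣ ≡ k

  WithFirstLast : ∀ m → ℕ → Subgraph m → Set
  WithFirstLast m k (V , E) = WithLast m k (V , E) × T (has V 0)

  withoutFirst isolatedFirst joinedFirst : ∀ {m} → Subgraph m → Subgraph (suc m)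
  withoutFirst  (V , E) = false ∷ V , false ∷ E
  isolatedFirst (V , E) = true ∷ V , false ∷ E
  joinedFirst   (V , E) = true ∷ V , true ∷ E

  mutual
    withLast : ∀ m → ℕ → List (Subgraph m)
    withLast zero    zero    = (true ∷ [] , []) ∷ []
    withLast zero    (suc k) = []
    withLast (suc m) k       =
      map withoutFirst (withLast m k) ++ (map isolatedFirst (withLast m k) ++ map joinedFirst (shift (withFirstLast m) k))

    withFirstLast : ∀ m → ℕ → List (Subgraph m)
    withFirstLast zero    zero    = (true ∷ [] , []) ∷ []
    withFirstLast zero    (suc k) = []
    withFirstLast (suc m) k       = map isolatedFirst (withLast m k) ++ map joinedFirst (shift (withFirstLast m) k)

  length-withLast : ∀ m → (∀ k → length (withLast m k) ≡ kimb (suc m) k) ×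
                          (∀ k → length (withFirstLast m k) + kimb m k ≡ kimb (suc m) k)
  length-withLast zero = (λ { zero → refl ; (suc k) → refl }) , (λ { zero → refl ; (suc k) → refl })
  length-withLast (suc m) = lengthL , lengthFL
    where
    L = proj₁ (length-withLast m)
    FL = proj₂ (length-withLast m)
    shifted : ℕ → ℕ
    shifted k = length (shift (withFirstLast m) k)

    shift-balance : ∀ k → kimbShift m k + shifted k ≡ kimbShift (suc m) k
    shift-balance zero    = refl
    shift-balance (suc k) = trans (+-comm (kimb m k) _) (FL k)

    key : ∀ k → kimb (suc m) k + shifted k ≡ kimbShift (suc m) k + kimb₀ (suc m) k
    key k = begin
      kimb m k + (kimbShift m k + kimb₀ m k) + shifted k
        ≡⟨ solve 4 (λ p s z w → p :+ (s :+ z) :+ w := (s :+ w) :+ (p :+ z)) refl (kimb m k) (kimbShift m k) (kimb₀ m k) (shifted k) ⟩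
      (kimbShift m k + shifted k) + kimb₀ (suc m) k ≡⟨ cong (_+ kimb₀ (suc m) k) (shift-balance k) ⟩
      kimbShift (suc m) k + kimb₀ (suc m) k ∎
      where open ≡-Reasoning

    lengthL : ∀ k → length (withLast (suc m) k) ≡ kimb (suc (suc m)) k
    lengthL k = begin
      length (withLast (suc m) k)
        ≡⟨ trans (length-map-++ withoutFirst (withLast m k) _)
                 (cong (length (withLast m k) +_) (length-map-++-map isolatedFirst joinedFirst (withLast m k) _)) ⟩
      length (withLast m k) + (length (withLast m k) + shifted k) ≡⟨ cong (λ x → x + (x + shifted k)) (L k) ⟩
      kimb (suc m) k + (kimb (suc m) k + shifted k)                ≡⟨ cong (kimb (suc m) k +_) (key k) ⟩
      kimb (suc (suc m)) k                                          ∎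
      where open ≡-Reasoning

    lengthFL : ∀ k → length (withFirstLast (suc m) k) + kimb (suc m) k ≡ kimb (suc (suc m)) k
    lengthFL k = begin
      length (withFirstLast (suc m) k) + kimb (suc m) k
        ≡⟨ cong (_+ kimb (suc m) k) (length-map-++-map isolatedFirst joinedFirst (withLast m k) _) ⟩
      length (withLast m k) + shifted k + kimb (suc m) k ≡⟨ cong (λ x → x + shifted k + kimb (suc m) k) (L k) ⟩
      kimb (suc m) k + shifted k + kimb (suc m) k        ≡⟨ +-comm (kimb (suc m) k + shifted k) _ ⟩
      kimb (suc m) k + (kimb (suc m) k + shifted k)      ≡⟨ cong (kimb (suc m) k +_) (key k) ⟩
      kimb (suc (suc m)) k                               ∎
      where open ≡-Reasoning

  private
    edgesSupported-∷ : ∀ {m} x b (V : Vec Bool (suc m)) E → (T b → T x × T (has V 0)) →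
                       EdgesSupported (V , E) → EdgesSupported (x ∷ V , b ∷ E)
    edgesSupported-∷ x b V E first _    zero    = first
    edgesSupported-∷ x b V E _     rest (suc e) = rest e

    withLast-withoutFirst : ∀ {m k} VE → WithLast m k VE → WithLast (suc m) k (withoutFirst VE)
    withLast-withoutFirst (V , E) (supported , last , size) = edgesSupported-∷ false false V E (λ ()) supported , last , size

    withLast-isolatedFirst : ∀ {m k} VE → WithLast m k VE → WithFirstLast (suc m) k (isolatedFirst VE)
    withLast-isolatedFirst (V , E) (supported , last , size) = (edgesSupported-∷ true false V E (λ ()) supported , last , size) , tt

    withLast-joinedFirst : ∀ {m} k VE → Shift (WithFirstLast m) k VE → WithFirstLast (suc m) k (joinedFirst VE)
    withLast-joinedFirst (suc k) (V , E) ((supported , last , refl) , first) =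
      (edgesSupported-∷ true true V E (λ _ → tt , first) supported , last , refl) , tt

  mutual
    enumerates-withLast : ∀ m k → Enumerates (WithLast m k) (withLast m k)
    enumerates-withLast zero zero = enumerates-singleton (true ∷ [] , []) only ((λ _ ()) , tt , refl)
      where
      only : ∀ VE → WithLast 0 0 VE → VE ≡ (true ∷ [] , [])
      only (true ∷ [] , [])  _ = refl
      only (false ∷ [] , []) (_ , () , _)
    enumerates-withLast zero (suc k) = enumerates-[] λ { (V , []) (_ , _ , ()) }
    enumerates-withLast (suc m) k = enumerates-⊎₃
      (enumerates-map withoutFirst (λ { _ _ refl → refl }) (enumerates-withLast m k))
      (enumerates-map isolatedFirst (λ { _ _ refl → refl }) (enumerates-withLast m k))
      (enumerates-map joinedFirst (λ { _ _ refl → refl }) (enumerates-shift (enumerates-withFirstLast m) k))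
      (λ { _ (_ , _ , refl) (_ , _ , ()) })
      (λ { _ (_ , _ , refl) (_ , _ , ()) })
      (λ { _ (_ , _ , refl) (_ , _ , ()) })
      split
      (λ { _ (VE , P , refl) → withLast-withoutFirst VE P })
      (λ { _ (VE , P , refl) → proj₁ (withLast-isolatedFirst VE P) })
      (λ { _ (VE , P , refl) → proj₁ (withLast-joinedFirst k VE P) })
      where
      split : ∀ VE → WithLast (suc m) k VE →
              Image withoutFirst (WithLast m k) VE ⊎ (Image isolatedFirst (WithLast m k) VE ⊎ Image joinedFirst (Shift (WithFirstLast m) k) VE)
      split (false ∷ V , false ∷ E) (supported , last , size) = inj₁ ((V , E) , (supported ∘ suc , last , size) , refl)
      split (true ∷ V , false ∷ E) (supported , last , size) = inj₂ (inj₁ ((V , E) , (supported ∘ suc , last , size) , refl))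
      split (true ∷ V , true ∷ E) (supported , last , refl) =
        inj₂ (inj₂ ((V , E) , ((supported ∘ suc , last , refl) , proj₂ (supported 0 tt)) , refl))
      split (false ∷ V , true ∷ E) (supported , _) = ⊥-elim (proj₁ (supported 0 tt))

    enumerates-withFirstLast : ∀ m k → Enumerates (WithFirstLast m k) (withFirstLast m k)
    enumerates-withFirstLast zero zero = enumerates-singleton (true ∷ [] , []) only (((λ _ ()) , tt , refl) , tt)
      where
      only : ∀ VE → WithFirstLast 0 0 VE → VE ≡ (true ∷ [] , [])
      only (true ∷ [] , [])  _ = refl
      only (false ∷ [] , []) (_ , ())
    enumerates-withFirstLast zero (suc k) = enumerates-[] λ { (V , []) ((_ , _ , ()) , _) }
    enumerates-withFirstLast (suc m) k = enumerates-⊎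
      (enumerates-map isolatedFirst (λ { _ _ refl → refl }) (enumerates-withLast m k))
      (enumerates-map joinedFirst (λ { _ _ refl → refl }) (enumerates-shift (enumerates-withFirstLast m) k))
      (λ { _ (_ , _ , refl) (_ , _ , ()) })
      split
      (λ { _ (VE , P , refl) → withLast-isolatedFirst VE P })
      (λ { _ (VE , P , refl) → withLast-joinedFirst k VE P })
      where
      split : ∀ VE → WithFirstLast (suc m) k VE →
              Image isolatedFirst (WithLast m k) VE ⊎ Image joinedFirst (Shift (WithFirstLast m) k) VE
      split (true ∷ V , false ∷ E) ((supported , last , size) , _) = inj₁ ((V , E) , (supported ∘ suc , last , size) , refl)
      split (true ∷ V , true ∷ E) ((supported , last , refl) , _) = inj₂ ((V , E) , ((supported ∘ suc , last , refl) , proj₂ (supported 0 tt)) , refl)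
      split (false ∷ V , _ ∷ E) (_ , ())

  private
    ∈⇒has : ∀ {n} (V : Vec Bool n) f → f Subset.∈ V → T (has V (toℕ f))
    ∈⇒has (_ ∷ V) fzero    Vec.here        = tt
    ∈⇒has (_ ∷ V) (fsuc f) (Vec.there f∈V) = ∈⇒has V f f∈V

    has⇒∈ : ∀ {n} (V : Vec Bool n) f → T (has V (toℕ f)) → f Subset.∈ V
    has⇒∈ (true ∷ V) fzero    _       = Vec.here
    has⇒∈ (_ ∷ V)    (fsuc f) present = Vec.there (has⇒∈ V f present)

    inV⇒has : ∀ {n} (V : Vec Bool n) j → InV V (suc j) → T (has V j)
    inV⇒has V j (f , label≡ , f∈V) = subst (T ∘ has V) (suc-injective label≡) (∈⇒has V f f∈V)

    has⇒inV : ∀ {n} (V : Vec Bool n) j → T (has V j) → InV V (suc j)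
    has⇒inV V j present = f , cong suc f≡j , has⇒∈ V f (subst (T ∘ has V) (sym f≡j) present)
      where
      f = fromℕ< (has⇒< V j present)
      f≡j = toℕ-fromℕ< (has⇒< V j present)

  subgraph⇔withLast : ∀ m k VE → IsSubgraphWithLastVertex (suc m) k VE ⇔ WithLast m k VE
  subgraph⇔withLast m k (V , E) = mk⇔
    (λ (_ , edges , last , size) → supported edges , inV⇒has V m last , size)
    (λ (supported , last , size) → (fromℕ< (has⇒< V m last) , proj₂ (proj₂ (has⇒inV V m last))) ,
       (λ e e∈E → let ends = supported (toℕ e) (∈⇒has E e e∈E) in
                  has⇒inV V (toℕ e) (proj₁ ends) , has⇒inV V (suc (toℕ e)) (proj₂ ends)) ,
       has⇒inV V m last , size)
    where
    supported : (∀ e → e Subset.∈ E → InV V (suc (toℕ e)) × InV V (suc (suc (toℕ e)))) → EdgesSupported (V , E)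
    supported edges e present = subst (T ∘ has V) f≡e (inV⇒has V (toℕ f) (proj₁ ends)) ,
                            subst (T ∘ has V ∘ suc) f≡e (inV⇒has V (suc (toℕ f)) (proj₂ ends))
      where
      f = fromℕ< (has⇒< E e present)
      f≡e = toℕ-fromℕ< (has⇒< E e present)
      ends = edges f (has⇒∈ E f (subst (T ∘ has E) (sym f≡e) present))

  subgraph-hasCard : ∀ m k → HasCard (IsSubgraphWithLastVertex (suc m) k) (kimb (suc m) k)
  subgraph-hasCard m k = subst (HasCard (IsSubgraphWithLastVertex (suc m) k)) (proj₁ (length-withLast m) k)
    (hasCard (enumerates-⇔ (λ VE → Equivalence.from (subgraph⇔withLast m k VE)) (λ VE → Equivalence.to (subgraph⇔withLast m k VE))
                           (enumerates-withLast m k)))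

module Connectivity where

  open import Data.Bool.ListAction using (any; all)
  open import Data.List.Relation.Unary.Any.Properties using (any⁺; any⁻)
  open import Data.List.Relation.Unary.All.Properties using (all⁻; applyUpTo⁺₁)
  open import Data.List.Membership.Propositional using (find; lose)
  open import Data.List.Membership.Propositional.Properties using (∈-filter⁺; ∈-applyUpTo⁺)

  private
    T-not : ∀ {b} → ¬ T b → T (not b)
    T-not {false} _  = tt
    T-not {true}  ¬T = ¬T tt

    T-not-elim : ∀ {b} → T (not b) → T b → ⊥
    T-not-elim {false} _ ()
    T-not-elim {true}  ()

  module _ (A : List (ℕ × ℕ)) where

    spread-⊇ : ∀ R v → T (R v) → T (spread A R v)
    spread-⊇ R v = Equivalence.from T-∨ ∘ inj₁

    spread-edge : ∀ R {u v} → T (R u) → (u , v) ∈ A ⊎ (v , u) ∈ A → T (spread A R v)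
    spread-edge R {u} {v} Ru (inj₁ uv∈A) = Equivalence.from (T-∨ {R v}) (inj₂ (any⁺ _ (lose uv∈A
      (Equivalence.from T-∨ (inj₁ (Equivalence.from T-∧ (Ru , ≡⇒≡ᵇ v v refl)))))))
    spread-edge R {u} {v} Ru (inj₂ vu∈A) = Equivalence.from (T-∨ {R v}) (inj₂ (any⁺ _ (lose vu∈A
      (Equivalence.from (T-∨ {R v ∧ (u ≡ᵇ v)}) (inj₂ (Equivalence.from T-∧ (Ru , ≡⇒≡ᵇ v v refl)))))))

    iter-mono : ∀ R v {t t′} → t ≤ t′ → T (iter t (spread A) R v) → T (iter t′ (spread A) R v)
    iter-mono R v {t} {zero}   z≤n = id
    iter-mono R v {t} {suc t′} t≤t′+1 with m≤n⇒m<n∨m≡n t≤t′+1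
    ... | inj₂ refl          = id
    ... | inj₁ (s≤s t≤t′) = spread-⊇ (iter t′ (spread A) R) v ∘ iter-mono R v t≤t′

    Closed : (ℕ → Set) → Set
    Closed W = ∀ {a b} → (a , b) ∈ A → (W a → W b) × (W b → W a)

    iter-avoids : ∀ {W} → Closed W → ∀ R → (∀ v → T (R v) → ¬ W v) → ∀ t v → T (iter t (spread A) R v) → ¬ W v
    iter-avoids closed R avoids zero    = avoids
    iter-avoids closed R avoids (suc t) v reached with Equivalence.to T-∨ reached
    ... | inj₁ before = iter-avoids closed R avoids t v before
    ... | inj₂ viaEdge with find (any⁻ _ A viaEdge)
    ...   | (a , b) , ab∈A , used with Equivalence.to T-∨ used
    ...     | inj₁ forward  = let Ra , b≡v = Equivalence.to T-∧ forward in
      λ Wv → iter-avoids closed R avoids t a Ra (proj₂ (closed ab∈A) (subst _ (sym (≡ᵇ⇒≡ b v b≡v)) Wv))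
    ...     | inj₂ backward = let Rb , a≡v = Equivalence.to T-∧ backward in
      λ Wv → iter-avoids closed R avoids t b Rb (proj₁ (closed ab∈A) (subst _ (sym (≡ᵇ⇒≡ a v a≡v)) Wv))

    private
      Leader? : ∀ size → Decidable λ v → T (all (λ u → not (connected size A u v)) (upTo v))
      Leader? size v = T? (all (λ u → not (connected size A u v)) (upTo v))

    components≡1 : ∀ n → (∀ j → j < n → T (connected (suc n) A 0 (suc j))) → components (suc n) A ≡ 1
    components≡1 n reached rewrite filter-accept (Leader? (suc n)) {0} {applyUpTo suc n} tt =
      cong suc (CountFilter.count-none (Leader? (suc n)) suc n λ j j<n leader →
        T-not-elim (proj₁ (Equivalence.to T-∧ leader)) (reached j j<n))

    2≤components : ∀ n j → j < n → (∀ u → u < suc j → ¬ T (connected (suc n) A u (suc j))) → 2 ≤ components (suc n) A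
    2≤components n j j<n unreached rewrite filter-accept (Leader? (suc n)) {0} {applyUpTo suc n} tt =
      s≤s (nonEmpty (∈-filter⁺ (Leader? (suc n)) (∈-applyUpTo⁺ suc j<n)
        (all⁻ _ (applyUpTo⁺₁ id (suc j) λ {u} u<j+1 → T-not (unreached u u<j+1)))))
      where
      nonEmpty : ∀ {x : ℕ} {xs} → x ∈ xs → 1 ≤ length xs
      nonEmpty (here _)  = s≤s z≤n
      nonEmpty (there _) = s≤s z≤n

module FanConnectivity where

  open Fan using (pathEdge; spokeEdge)
  open BoolVec
  open Connectivity

  select : ∀ {X : Set} {k} → Vec Bool k → (ℕ → X) → List X
  select []          h = []
  select (true ∷ β)  h = h 0 ∷ select β (h ∘ suc)
  select (false ∷ β) h = select β (h ∘ suc)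

  select-∈⁻ : ∀ {X : Set} {k} (β : Vec Bool k) (h : ℕ → X) {x} → x ∈ select β h → ∃ λ i → T (has β i) × x ≡ h i
  select-∈⁻ (true ∷ β)  h (here refl) = 0 , tt , refl
  select-∈⁻ (true ∷ β)  h (there x∈)  = let i , βi , x≡ = select-∈⁻ β (h ∘ suc) x∈ in suc i , βi , x≡
  select-∈⁻ (false ∷ β) h x∈          = let i , βi , x≡ = select-∈⁻ β (h ∘ suc) x∈ in suc i , βi , x≡

  select-∈⁺ : ∀ {X : Set} {k} (β : Vec Bool k) (h : ℕ → X) i → T (has β i) → h i ∈ select β h
  select-∈⁺ (true ∷ β)  h zero    _  = here refl
  select-∈⁺ (true ∷ β)  h (suc i) βi = there (select-∈⁺ β (h ∘ suc) i βi)
  select-∈⁺ (false ∷ β) h (suc i) βi = select-∈⁺ β (h ∘ suc) i βi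

  -- Vertices i + 1 and j + 1 are joined by path edges {t + 1, t + 2} with T (b t).
  Linked : (ℕ → Bool) → ℕ → ℕ → Set
  Linked b i j = ∀ t → i ≤ t × t < j ⊎ j ≤ t × t < i → T (b t)

  Linked-refl : ∀ b i → Linked b i i
  Linked-refl b i t (inj₁ (i≤t , t<i)) = ⊥-elim (<⇒≱ t<i i≤t)
  Linked-refl b i t (inj₂ (i≤t , t<i)) = ⊥-elim (<⇒≱ t<i i≤t)

  Linked-sym : ∀ b {i j} → Linked b i j → Linked b j i
  Linked-sym b linked t = linked t ∘ Sum.swap

  Linked-suc : ∀ b {i v} → T (b i) → Linked b i v → Linked b (suc i) v
  Linked-suc b {i} bi linked t (inj₁ (i<t , t<v)) = linked t (inj₁ (<⇒≤ i<t , t<v))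
  Linked-suc b {i} bi linked t (inj₂ (v≤t , t<i+1)) with m≤n⇒m<n∨m≡n (s≤s⁻¹ t<i+1)
  ... | inj₁ t<i  = linked t (inj₂ (v≤t , t<i))
  ... | inj₂ refl = bi

  Linked-pred : ∀ b {i v} → T (b i) → Linked b (suc i) v → Linked b i v
  Linked-pred b {i} bi linked t (inj₁ (i≤t , t<v)) with m≤n⇒m<n∨m≡n i≤t
  ... | inj₁ i<t  = linked t (inj₁ (i<t , t<v))
  ... | inj₂ refl = bi
  Linked-pred b linked bi t (inj₂ (v≤t , t<i)) = bi t (inj₂ (v≤t , <-trans t<i (n<1+n _)))

  -- The first vertex of the block of path edges containing v.
  blockStart : (ℕ → Bool) → ℕ → ℕ
  blockStart b zero    = 0
  blockStart b (suc i) = if b i then blockStart b i else suc i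

  blockStart-≤ : ∀ b v → blockStart b v ≤ v
  blockStart-≤ b zero    = z≤n
  blockStart-≤ b (suc i) with b i
  ... | true  = ≤-trans (blockStart-≤ b i) (n≤1+n i)
  ... | false = ≤-refl

  blockStart-linked : ∀ b v → Linked b (blockStart b v) v
  blockStart-linked b zero    = Linked-refl b 0
  blockStart-linked b (suc i) with b i in bi
  ... | true  = Linked-sym b (Linked-suc b (subst T (sym bi) tt) (Linked-sym b (blockStart-linked b i)))
  ... | false = Linked-refl b (suc i)

  blockStart-least : ∀ b v j → j < blockStart b v → ¬ Linked b j v
  blockStart-least b (suc i) j j<start linked with b i in bi
  ... | true  = blockStart-least b i j j<start (Linked-sym b (Linked-pred b (subst T (sym bi) tt) (Linked-sym b linked)))
  ... | false = subst T bi (linked i (inj₁ (s≤s⁻¹ j<start , ≤-refl)))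

  module FanSubgraph (m : ℕ) (β : Vec Bool m) (σ : Vec Bool (suc m)) where

    chosenEdges : List (ℕ × ℕ)
    chosenEdges = select β pathEdge ++ select σ spokeEdge

    private
      path∈ : ∀ i → T (has β i) → pathEdge i ∈ chosenEdges
      path∈ i βi = ∈-++⁺ˡ (select-∈⁺ β pathEdge i βi)

      spoke∈ : ∀ i → T (has σ i) → spokeEdge i ∈ chosenEdges
      spoke∈ i σi = ∈-++⁺ʳ (select β pathEdge) (select-∈⁺ σ spokeEdge i σi)

      edge-cases : ∀ {e} → e ∈ chosenEdges → (∃ λ i → T (has β i) × e ≡ pathEdge i) ⊎ (∃ λ i → T (has σ i) × e ≡ spokeEdge i)
      edge-cases e∈ = Sum.map (select-∈⁻ β pathEdge) (select-∈⁻ σ spokeEdge) (∈-++⁻ (select β pathEdge) e∈)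

      fromSink : ℕ → Bool
      fromSink = 0 ≡ᵇ_

      Reaches : ℕ → ℕ → Set
      Reaches t w = T (iter t (spread chosenEdges) fromSink w)

      reach-spoke : ∀ t → T (has σ t) → Reaches 1 (suc t)
      reach-spoke t σt = spread-edge chosenEdges fromSink tt (inj₁ (spoke∈ t σt))

      reach-right : ∀ t v → T (has σ t) → Linked (has β) t v → ∀ d → t + d ≤ v → Reaches (suc d) (suc (t + d))
      reach-right t v σt linked zero    _ rewrite +-identityʳ t = reach-spoke t σt
      reach-right t v σt linked (suc d) t+d+1≤v rewrite +-suc t d =
        spread-edge chosenEdges (iter (suc d) (spread chosenEdges) fromSink) (reach-right t v σt linked d (≤-trans (n≤1+n _) t+d+1≤v))
          (inj₁ (path∈ (t + d) (linked (t + d) (inj₁ (m≤m+n t d , t+d+1≤v)))))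

      reach-left : ∀ t v → T (has σ t) → Linked (has β) t v → ∀ d → d + v ≤ t → Reaches (suc d) (suc (t ∸ d))
      reach-left t v σt linked zero    _ = reach-spoke t σt
      reach-left t v σt linked (suc d) d+1+v≤t =
        spread-edge chosenEdges (iter (suc d) (spread chosenEdges) fromSink) (reach-left t v σt linked d (≤-trans (n≤1+n _) d+1+v≤t))
          (inj₂ (subst (λ u → (suc (t ∸ suc d) , suc u) ∈ chosenEdges) t-d-1+1≡t-d
            (path∈ (t ∸ suc d) (linked (t ∸ suc d) (inj₂ (v≤t-d-1 , t-d-1<t))))))
        where
        d<t : d < t
        d<t = ≤-trans (s≤s (m≤m+n d v)) d+1+v≤t
        t-d-1+1≡t-d : suc (t ∸ suc d) ≡ t ∸ d
        t-d-1+1≡t-d = sym (+-∸-assoc 1 d<t)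
        v≤t-d-1 : v ≤ t ∸ suc d
        v≤t-d-1 = m+n≤o⇒m≤o∸n v (subst (_≤ t) (+-comm (suc d) v) d+1+v≤t)
        t-d-1<t : t ∸ suc d < t
        t-d-1<t = subst (_≤ t) (sym t-d-1+1≡t-d) (m∸n≤m t d)

    spoke-linked⇒connected : ∀ v t → v < suc m → T (has σ t) → Linked (has β) t v →
                             T (connected (suc (suc m)) chosenEdges 0 (suc v))
    spoke-linked⇒connected v t v<n σt linked with ≤-<-connex t v
    ... | inj₁ t≤v = iter-mono chosenEdges fromSink (suc v) (s≤s (≤-trans (m∸n≤m v t) (<⇒≤ v<n)))
          (subst (Reaches (suc (v ∸ t)) ∘ suc) (m+[n∸m]≡n t≤v) (reach-right t v σt linked (v ∸ t) (≤-reflexive (m+[n∸m]≡n t≤v))))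
    ... | inj₂ v<t = iter-mono chosenEdges fromSink (suc v) (s≤s (≤-trans (m∸n≤m t v) (<⇒≤ (has⇒< σ t σt))))
          (subst (Reaches (suc (t ∸ v)) ∘ suc) (m∸[m∸n]≡n (<⇒≤ v<t)) (reach-left t v σt linked (t ∸ v) (≤-reflexive (m∸n+n≡m (<⇒≤ v<t)))))

    -- If no spoke meets the block of v, the first vertex of that block is reachable from no
    -- smaller vertex, since the vertices of the block form a union of components.
    unspoked⇒unreached : ∀ v → v < suc m → (∀ t → T (has σ t) → ¬ Linked (has β) t v) →
                         ∃ λ j → j < suc m × (∀ u → u < suc j → ¬ T (connected (suc (suc m)) chosenEdges u (suc j)))
    unspoked⇒unreached v v<n unspoked = start , ≤-<-trans (blockStart-≤ (has β) v) v<n , unreached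
      where
      start = blockStart (has β) v
      InBlock : ℕ → Set
      InBlock x = ∃ λ i → x ≡ suc i × Linked (has β) i v
      closed : Closed chosenEdges InBlock
      closed e∈ with edge-cases e∈
      ... | inj₁ (i , βi , refl) = (λ { (_ , refl , linked) → suc i , refl , Linked-suc (has β) βi linked })
                                 , (λ { (_ , refl , linked) → i , refl , Linked-pred (has β) βi linked })
      ... | inj₂ (i , σi , refl) = (λ { (_ , () , _) }) , (λ { (_ , refl , linked) → ⊥-elim (unspoked i σi linked) })
      unreached : ∀ u → u < suc start → ¬ T (connected (suc (suc m)) chosenEdges u (suc start))
      unreached u u≤start reached = iter-avoids chosenEdges closed (u ≡ᵇ_) avoids (suc (suc m)) (suc start) reached
        (start , refl , blockStart-linked (has β) v)
        where
        avoids : ∀ w → T (u ≡ᵇ w) → ¬ InBlock w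
        avoids w u≡w (i , refl , linked) with ≡ᵇ⇒≡ u (suc i) u≡w
        ... | refl = blockStart-least (has β) v i (s≤s⁻¹ u≤start) linked

-- Scanning F_{m+1} from vertex 1: s records whether the current block of path edges already
-- contains a spoke.  A block without spoke is cut off from the sink; a block with j spokes
-- contributes j - 1 independent cycles.
module SpanningScan where

  open BoolVec
  open FanConnectivity

  spans : ∀ {m} → Bool → Vec Bool (suc m) → Vec Bool m → Bool
  spans {zero}  s (v ∷ []) []          = s ∨ v
  spans {suc m} s (v ∷ σ)  (true ∷ β)  = spans (s ∨ v) σ β
  spans {suc m} s (v ∷ σ)  (false ∷ β) = (s ∨ v) ∧ spans false σ β

  nullity : ∀ {m} → Bool → Vec Bool (suc m) → Vec Bool m → ℕ
  nullity {zero}  s (v ∷ []) []          = bit (s ∧ v)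
  nullity {suc m} s (v ∷ σ)  (true ∷ β)  = bit (s ∧ v) + nullity (s ∨ v) σ β
  nullity {suc m} s (v ∷ σ)  (false ∷ β) = bit (s ∧ v) + nullity false σ β

  private
    Linked-∷ : ∀ {m} b (β : Vec Bool m) {i j} → Linked (has β) i j → Linked (has (b ∷ β)) (suc i) (suc j)
    Linked-∷ b β linked zero    (inj₁ (() , _))
    Linked-∷ b β linked zero    (inj₂ (() , _))
    Linked-∷ b β linked (suc t) (inj₁ (s≤s i≤t , s≤s t<j)) = linked t (inj₁ (i≤t , t<j))
    Linked-∷ b β linked (suc t) (inj₂ (s≤s j≤t , s≤s t<i)) = linked t (inj₂ (j≤t , t<i))

    Linked-∷⁻ : ∀ {m} b (β : Vec Bool m) {i j} → Linked (has (b ∷ β)) (suc i) (suc j) → Linked (has β) i j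
    Linked-∷⁻ b β linked t (inj₁ (i≤t , t<j)) = linked (suc t) (inj₁ (s≤s i≤t , s≤s t<j))
    Linked-∷⁻ b β linked t (inj₂ (j≤t , t<i)) = linked (suc t) (inj₂ (s≤s j≤t , s≤s t<i))

    Linked-0∷ : ∀ {m} b (β : Vec Bool m) {j} → T b → Linked (has β) 0 j → Linked (has (b ∷ β)) 0 (suc j)
    Linked-0∷ b β Tb linked zero    (inj₁ _)                = Tb
    Linked-0∷ b β Tb linked (suc t) (inj₁ (_ , s≤s t<j))    = linked t (inj₁ (z≤n , t<j))

    Linked-0∷⁻ : ∀ {m} b (β : Vec Bool m) {j} → Linked (has (b ∷ β)) 0 (suc j) → T b × Linked (has β) 0 j
    Linked-0∷⁻ b β linked = linked 0 (inj₁ (z≤n , z<s)) , λ { t (inj₁ (_ , t<j)) → linked (suc t) (inj₁ (z≤n , s≤s t<j)) }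

  private
    viaFirst : ∀ {k l} s v (σ : Vec Bool k) (β : Vec Bool l) {w} → T (s ∨ v) → Linked (has β) 0 w →
               (∃ λ t → T (has (v ∷ σ) t) × Linked (has β) t w) ⊎ (T s × Linked (has β) 0 w)
    viaFirst s v σ β s∨v linked with Equivalence.to (T-∨ {s}) s∨v
    ... | inj₁ Ts = inj₂ (Ts , linked)
    ... | inj₂ Tv = inj₁ (0 , Tv , linked)

  Spanned : ∀ {m} → Bool → Vec Bool (suc m) → Vec Bool m → Set
  Spanned {m} s σ β = ∀ w → w < suc m → (∃ λ t → T (has σ t) × Linked (has β) t w) ⊎ (T s × Linked (has β) 0 w)

  spans⇒spanned : ∀ {m} s (σ : Vec Bool (suc m)) β → T (spans s σ β) → Spanned s σ β
  spans⇒spanned {zero}  s (v ∷ []) [] s∨v zero    _        = viaFirst s v [] [] s∨v (Linked-refl _ 0)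
  spans⇒spanned {zero}  s (v ∷ []) [] _   (suc w) (s≤s ())
  spans⇒spanned {suc m} s (v ∷ σ) (true ∷ β) spanning zero _ with spans⇒spanned (s ∨ v) σ β spanning 0 z<s
  ... | inj₁ (t , σt , linked) = inj₁ (suc t , σt , Linked-sym _ (Linked-0∷ true β tt (Linked-sym _ linked)))
  ... | inj₂ (s∨v , _)         = viaFirst s v σ (true ∷ β) s∨v (Linked-refl _ 0)
  spans⇒spanned {suc m} s (v ∷ σ) (true ∷ β) spanning (suc w) (s≤s w<m+1) with spans⇒spanned (s ∨ v) σ β spanning w w<m+1
  ... | inj₁ (t , σt , linked) = inj₁ (suc t , σt , Linked-∷ true β linked)
  ... | inj₂ (s∨v , linked)    = viaFirst s v σ (true ∷ β) s∨v (Linked-0∷ true β tt linked)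
  spans⇒spanned {suc m} s (v ∷ σ) (false ∷ β) spanning zero _ =
    viaFirst s v σ (false ∷ β) (proj₁ (Equivalence.to (T-∧ {s ∨ v}) spanning)) (Linked-refl _ 0)
  spans⇒spanned {suc m} s (v ∷ σ) (false ∷ β) spanning (suc w) (s≤s w<m+1)
    with spans⇒spanned false σ β (proj₂ (Equivalence.to (T-∧ {s ∨ v}) spanning)) w w<m+1
  ... | inj₁ (t , σt , linked) = inj₁ (suc t , σt , Linked-∷ false β linked)
  ... | inj₂ (() , _)

  Unspanned : ∀ {m} → Bool → Vec Bool (suc m) → Vec Bool m → Set
  Unspanned {m} s σ β = ∃ λ w → w < suc m × (∀ t → T (has σ t) → ¬ Linked (has β) t w) × (T s → ¬ Linked (has β) 0 w)

  ¬spans⇒unspanned : ∀ {m} s (σ : Vec Bool (suc m)) β → ¬ T (spans s σ β) → Unspanned s σ β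
  ¬spans⇒unspanned {zero} s (v ∷ []) [] ¬s∨v = 0 , z<s , unspoked , λ Ts _ → ¬s∨v (Equivalence.from T-∨ (inj₁ Ts))
    where
    unspoked : ∀ t → T (has (v ∷ []) t) → ¬ Linked (has []) t 0
    unspoked zero Tv _ = ¬s∨v (Equivalence.from (T-∨ {s}) (inj₂ Tv))
  ¬spans⇒unspanned {suc m} s (v ∷ σ) (true ∷ β) ¬spanning with ¬spans⇒unspanned (s ∨ v) σ β ¬spanning
  ... | w , w<m+1 , unspoked , ¬start = suc w , s≤s w<m+1 , unspoked′ , λ Ts linked →
          ¬start (Equivalence.from T-∨ (inj₁ Ts)) (proj₂ (Linked-0∷⁻ true β linked))
    where
    unspoked′ : ∀ t → T (has (v ∷ σ) t) → ¬ Linked (has (true ∷ β)) t (suc w)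
    unspoked′ zero    Tv linked = ¬start (Equivalence.from (T-∨ {s}) (inj₂ Tv)) (proj₂ (Linked-0∷⁻ true β linked))
    unspoked′ (suc t) σt linked = unspoked t σt (Linked-∷⁻ true β linked)
  ¬spans⇒unspanned {suc m} s (v ∷ σ) (false ∷ β) ¬spanning with T? (s ∨ v)
  ... | no ¬s∨v = 0 , z<s , unspoked , λ Ts _ → ¬s∨v (Equivalence.from T-∨ (inj₁ Ts))
    where
    unspoked : ∀ t → T (has (v ∷ σ) t) → ¬ Linked (has (false ∷ β)) t 0
    unspoked zero    Tv _      = ¬s∨v (Equivalence.from (T-∨ {s}) (inj₂ Tv))
    unspoked (suc t) _  linked = proj₁ (Linked-0∷⁻ false β (Linked-sym _ linked))
  ... | yes s∨v with ¬spans⇒unspanned false σ β (¬spanning ∘ λ rest → Equivalence.from T-∧ (s∨v , rest))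
  ...   | w , w<m+1 , unspoked , _ = suc w , s≤s w<m+1 , unspoked′ , λ _ linked → proj₁ (Linked-0∷⁻ false β linked)
    where
    unspoked′ : ∀ t → T (has (v ∷ σ) t) → ¬ Linked (has (false ∷ β)) t (suc w)
    unspoked′ zero    _  linked = proj₁ (Linked-0∷⁻ false β linked)
    unspoked′ (suc t) σt linked = unspoked t σt (Linked-∷⁻ false β linked)

  nullity-size : ∀ {m} s (σ : Vec Bool (suc m)) β → T (spans s σ β) → nullity s σ β + suc m ≡ ones σ + ones β + bit s
  nullity-size {zero} true  (true  ∷ []) [] _ = refl
  nullity-size {zero} true  (false ∷ []) [] _ = refl
  nullity-size {zero} false (true  ∷ []) [] _ = refl
  nullity-size {suc m} s (v ∷ σ) (true ∷ β) spanning = begin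
    bit (s ∧ v) + nullity (s ∨ v) σ β + suc (suc m)
      ≡⟨ solve 3 (λ a x m → a :+ x :+ (con 2 :+ m) := a :+ (x :+ (con 1 :+ m)) :+ con 1) refl (bit (s ∧ v)) (nullity (s ∨ v) σ β) m ⟩
    bit (s ∧ v) + (nullity (s ∨ v) σ β + suc m) + 1 ≡⟨ cong (λ x → bit (s ∧ v) + x + 1) (nullity-size (s ∨ v) σ β spanning) ⟩
    bit (s ∧ v) + (ones σ + ones β + bit (s ∨ v)) + 1
      ≡⟨ solve 4 (λ a o cs cb → a :+ (cs :+ cb :+ o) :+ con 1 := (a :+ o) :+ cs :+ cb :+ con 1) refl (bit (s ∧ v)) (bit (s ∨ v)) (ones σ) (ones β) ⟩
    (bit (s ∧ v) + bit (s ∨ v)) + ones σ + ones β + 1 ≡⟨ cong (λ x → x + ones σ + ones β + 1) (bit-∧+bit-∨ s v) ⟩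
    (bit v + bit s) + ones σ + ones β + 1
      ≡⟨ solve 4 (λ v s cs cb → (v :+ s) :+ cs :+ cb :+ con 1 := v :+ cs :+ (con 1 :+ cb) :+ s) refl (bit v) (bit s) (ones σ) (ones β) ⟩
    bit v + ones σ + suc (ones β) + bit s ∎
    where
    open ≡-Reasoning
    open +-*-Solver
    bit-∧+bit-∨ : ∀ s v → bit (s ∧ v) + bit (s ∨ v) ≡ bit v + bit s
    bit-∧+bit-∨ true  true  = refl
    bit-∧+bit-∨ true  false = refl
    bit-∧+bit-∨ false true  = refl
    bit-∧+bit-∨ false false = refl
  nullity-size {suc m} s (v ∷ σ) (false ∷ β) spanning = begin
    bit (s ∧ v) + nullity false σ β + suc (suc m)
      ≡⟨ solve 3 (λ a x m → a :+ x :+ (con 2 :+ m) := (a :+ con 1) :+ (x :+ (con 1 :+ m))) refl (bit (s ∧ v)) (nullity false σ β) m ⟩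
    (bit (s ∧ v) + 1) + (nullity false σ β + suc m) ≡⟨ cong₂ _+_ (bit-∧+1 s v s∨v) (nullity-size false σ β rest) ⟩
    (bit v + bit s) + (ones σ + ones β + 0)
      ≡⟨ solve 4 (λ v s cs cb → (v :+ s) :+ (cs :+ cb :+ con 0) := v :+ cs :+ cb :+ s) refl (bit v) (bit s) (ones σ) (ones β) ⟩
    bit v + ones σ + ones β + bit s ∎
    where
    open ≡-Reasoning
    open +-*-Solver
    s∨v = proj₁ (Equivalence.to (T-∧ {s ∨ v}) spanning)
    rest = proj₂ (Equivalence.to (T-∧ {s ∨ v}) spanning)
    bit-∧+1 : ∀ s v → T (s ∨ v) → bit (s ∧ v) + 1 ≡ bit v + bit s
    bit-∧+1 true  true  _ = refl
    bit-∧+1 true  false _ = refl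
    bit-∧+1 false true  _ = refl

module TuttePolynomial where

  open import Data.Integer as ℤ using (ℤ; +_; _^_)
  import Data.Integer.Properties as ℤ
  open import Data.Integer.Solver using () renaming (module +-*-Solver to ℤ-Solver)

  module IntegerSums where


    private
      variable
        X Y : Set

    sumOver : (X → ℤ) → List X → ℤ
    sumOver f xs = sumℤ (map f xs)

    sumOver-++ : ∀ (f : X → ℤ) xs ys → sumOver f (xs ++ ys) ≡ sumOver f xs ℤ.+ sumOver f ys
    sumOver-++ f []       ys = sym (ℤ.+-identityˡ _)
    sumOver-++ f (x ∷ xs) ys = trans (cong (λ t → f x ℤ.+ t) (sumOver-++ f xs ys)) (sym (ℤ.+-assoc (f x) _ _))

    sumOver-map : ∀ (f : Y → ℤ) (g : X → Y) xs → sumOver f (map g xs) ≡ sumOver (f ∘ g) xs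
    sumOver-map f g []       = refl
    sumOver-map f g (x ∷ xs) = cong (λ t → f (g x) ℤ.+ t) (sumOver-map f g xs)

    sumOver-cong : ∀ {f g : X → ℤ} xs → (∀ x → f x ≡ g x) → sumOver f xs ≡ sumOver g xs
    sumOver-cong []       f≗g = refl
    sumOver-cong (x ∷ xs) f≗g = cong₂ ℤ._+_ (f≗g x) (sumOver-cong xs f≗g)

    sumOver-+ : ∀ (f g : X → ℤ) xs → sumOver (λ x → f x ℤ.+ g x) xs ≡ sumOver f xs ℤ.+ sumOver g xs
    sumOver-+ f g []       = refl
    sumOver-+ f g (x ∷ xs) = trans (cong (λ t → f x ℤ.+ g x ℤ.+ t) (sumOver-+ f g xs))
      (solve 4 (λ a b c d → (a :+ b) :+ (c :+ d) := (a :+ c) :+ (b :+ d)) refl (f x) (g x) (sumOver f xs) (sumOver g xs))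
      where open ℤ-Solver

    sumOver-* : ∀ c (f : X → ℤ) xs → sumOver (λ x → c ℤ.* f x) xs ≡ c ℤ.* sumOver f xs
    sumOver-* c f []       = sym (ℤ.*-zeroʳ c)
    sumOver-* c f (x ∷ xs) = trans (cong (λ t → c ℤ.* f x ℤ.+ t) (sumOver-* c f xs)) (sym (ℤ.*-distribˡ-+ c (f x) (sumOver f xs)))

    sumOver-subsets-++ : ∀ (xs ys : List X) (f : List X → ℤ) →
      sumOver f (subsets (xs ++ ys)) ≡ sumOver (λ B → sumOver (λ C → f (B ++ C)) (subsets ys)) (subsets xs)
    sumOver-subsets-++ []       ys f = sym (ℤ.+-identityʳ _)
    sumOver-subsets-++ (x ∷ xs) ys f = begin
      sumOver f (map (x ∷_) (subsets (xs ++ ys)) ++ subsets (xs ++ ys))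
        ≡⟨ sumOver-++ f (map (x ∷_) (subsets (xs ++ ys))) (subsets (xs ++ ys)) ⟩
      sumOver f (map (x ∷_) (subsets (xs ++ ys))) ℤ.+ sumOver f (subsets (xs ++ ys))
        ≡⟨ cong₂ ℤ._+_ (trans (sumOver-map f (x ∷_) (subsets (xs ++ ys))) (sumOver-subsets-++ xs ys (f ∘ (x ∷_))))
                       (sumOver-subsets-++ xs ys f) ⟩
      sumOver (inner ∘ (x ∷_)) (subsets xs) ℤ.+ sumOver inner (subsets xs)
        ≡⟨ cong (ℤ._+ sumOver inner (subsets xs)) (sym (sumOver-map inner (x ∷_) (subsets xs))) ⟩
      sumOver inner (map (x ∷_) (subsets xs)) ℤ.+ sumOver inner (subsets xs)
        ≡⟨ sym (sumOver-++ inner (map (x ∷_) (subsets xs)) (subsets xs)) ⟩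
      sumOver inner (subsets (x ∷ xs)) ∎
      where
      open ≡-Reasoning
      inner = λ B → sumOver (λ C → f (B ++ C)) (subsets ys)

    allBoolVecs : ∀ k → List (Vec Bool k)
    allBoolVecs zero    = [] ∷ []
    allBoolVecs (suc k) = map (true ∷_) (allBoolVecs k) ++ map (false ∷_) (allBoolVecs k)

    sumOver-allBoolVecs : ∀ k (f : Vec Bool (suc k) → ℤ) →
      sumOver f (allBoolVecs (suc k)) ≡ sumOver (f ∘ (true ∷_)) (allBoolVecs k) ℤ.+ sumOver (f ∘ (false ∷_)) (allBoolVecs k)
    sumOver-allBoolVecs k f = trans (sumOver-++ f (map (true ∷_) (allBoolVecs k)) (map (false ∷_) (allBoolVecs k)))
      (cong₂ ℤ._+_ (sumOver-map f (true ∷_) (allBoolVecs k)) (sumOver-map f (false ∷_) (allBoolVecs k)))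

    sumOver-subsets-applyUpTo : ∀ (h : ℕ → X) k (f : List X → ℤ) →
      sumOver f (subsets (applyUpTo h k)) ≡ sumOver (λ β → f (FanConnectivity.select β h)) (allBoolVecs k)
    sumOver-subsets-applyUpTo h zero    f = refl
    sumOver-subsets-applyUpTo h (suc k) f = begin
      sumOver f (map (h 0 ∷_) S ++ S)                           ≡⟨ sumOver-++ f (map (h 0 ∷_) S) S ⟩
      sumOver f (map (h 0 ∷_) S) ℤ.+ sumOver f S                ≡⟨ cong (ℤ._+ sumOver f S) (sumOver-map f (h 0 ∷_) S) ⟩
      sumOver (f ∘ (h 0 ∷_)) S ℤ.+ sumOver f S
        ≡⟨ cong₂ ℤ._+_ (sumOver-subsets-applyUpTo (h ∘ suc) k (f ∘ (h 0 ∷_))) (sumOver-subsets-applyUpTo (h ∘ suc) k f) ⟩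
      sumOver (λ β → f (select (true ∷ β) h)) (allBoolVecs k) ℤ.+ sumOver (λ β → f (select (false ∷ β) h)) (allBoolVecs k)
        ≡⟨ sym (sumOver-allBoolVecs k (λ β → f (select β h))) ⟩
      sumOver (λ β → f (select β h)) (allBoolVecs (suc k)) ∎
      where
      open ≡-Reasoning
      open FanConnectivity using (select)
      S = subsets (applyUpTo (h ∘ suc) k)

  module TransferMatrix where

    open Fan
    open BoolVec
    open Connectivity
    open FanConnectivity
    open SpanningScan
    open IntegerSums

    summand : ℕ → ℤ → List (ℕ × ℕ) → ℤ
    summand m y A = ((+ 1 ℤ.- + 1) ^ (rank (suc (suc m)) (fanEdges (suc m)) ∸ rank (suc (suc m)) A))
                    ℤ.* ((y ℤ.- + 1) ^ (length A ∸ rank (suc (suc m)) A))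

    private
      select-all : ∀ {X : Set} k (h : ℕ → X) → select (replicate k true) h ≡ applyUpTo h k
      select-all zero    h = refl
      select-all (suc k) h = cong (h 0 ∷_) (select-all k (h ∘ suc))

      has-all : ∀ k j → j < k → T (has (replicate k true) j)
      has-all (suc k) zero    _         = tt
      has-all (suc k) (suc j) (s≤s j<k) = has-all k j j<k

      length-select : ∀ {X : Set} {k} (β : Vec Bool k) (h : ℕ → X) → length (select β h) ≡ ones β
      length-select []          h = refl
      length-select (true ∷ β)  h = cong suc (length-select β (h ∘ suc))
      length-select (false ∷ β) h = length-select β (h ∘ suc)

    rank-fan : ∀ m → rank (suc (suc m)) (fanEdges (suc m)) ≡ suc m
    rank-fan m = cong (suc (suc m) ∸_) (trans (cong (components (suc (suc m))) fanEdges≡chosen)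
      (components≡1 chosenEdges (suc m) λ j j<m+1 → spoke-linked⇒connected j j j<m+1 (has-all (suc m) j j<m+1) (Linked-refl _ j)))
      where
      open FanSubgraph m (replicate m true) (replicate (suc m) true)
      fanEdges≡chosen : fanEdges (suc m) ≡ chosenEdges
      fanEdges≡chosen = trans (fanEdges-applyUpTo (suc m)) (sym (cong₂ _++_ (select-all m pathEdge) (select-all (suc m) spokeEdge)))

    scanTerm : ∀ {m} → ℤ → Bool → Vec Bool (suc m) → Vec Bool m → ℤ
    scanTerm y s σ β = if spans s σ β then (y ℤ.- + 1) ^ nullity s σ β else + 0

    summand≡scanTerm : ∀ m y (β : Vec Bool m) (σ : Vec Bool (suc m)) →
                       summand m y (FanSubgraph.chosenEdges m β σ) ≡ scanTerm y false σ β
    summand≡scanTerm m y β σ with spans false σ β in spanning≡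
    ... | true = begin
      summand m y A                                           ≡⟨ cong₂ (λ r s → ((+ 1 ℤ.- + 1) ^ (r ∸ s)) ℤ.* ((y ℤ.- + 1) ^ (length A ∸ s))) (rank-fan m) rankA ⟩
      (+ 1 ℤ.- + 1) ^ (suc m ∸ suc m) ℤ.* (y ℤ.- + 1) ^ (length A ∸ suc m)
                                                              ≡⟨ cong (λ e → (+ 1 ℤ.- + 1) ^ e ℤ.* (y ℤ.- + 1) ^ (length A ∸ suc m)) (n∸n≡0 (suc m)) ⟩
      + 1 ℤ.* (y ℤ.- + 1) ^ (length A ∸ suc m)               ≡⟨ ℤ.*-identityˡ _ ⟩
      (y ℤ.- + 1) ^ (length A ∸ suc m)                        ≡⟨ cong ((y ℤ.- + 1) ^_) excess ⟩
      (y ℤ.- + 1) ^ nullity false σ β                         ∎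
      where
      open ≡-Reasoning
      open FanSubgraph m β σ
      A = chosenEdges
      spanning : T (spans false σ β)
      spanning = subst T (sym spanning≡) tt
      rankA : rank (suc (suc m)) A ≡ suc m
      rankA = cong (suc (suc m) ∸_) (components≡1 A (suc m) λ j j<m+1 → reach j<m+1 (spans⇒spanned false σ β spanning j j<m+1))
        where
        reach : ∀ {j} → j < suc m → (∃ λ t → T (has σ t) × Linked (has β) t j) ⊎ (T false × Linked (has β) 0 j) →
                T (connected (suc (suc m)) A 0 (suc j))
        reach j<m+1 (inj₁ (t , σt , linked)) = spoke-linked⇒connected _ t j<m+1 σt linked
      excess : length A ∸ suc m ≡ nullity false σ β
      excess = begin
        length A ∸ suc m             ≡⟨ cong (_∸ suc m) (trans (length-++ (select β pathEdge)) (cong₂ _+_ (length-select β pathEdge) (length-select σ spokeEdge))) ⟩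
        ones β + ones σ ∸ suc m      ≡⟨ cong (_∸ suc m) (trans (+-comm (ones β) (ones σ)) (sym (trans (nullity-size false σ β spanning) (+-identityʳ _)))) ⟩
        nullity false σ β + suc m ∸ suc m ≡⟨ m+n∸n≡m (nullity false σ β) (suc m) ⟩
        nullity false σ β            ∎
    ... | false = cong (λ e → (+ 1 ℤ.- + 1) ^ e ℤ.* (y ℤ.- + 1) ^ (length A ∸ rank (suc (suc m)) A)) rankGap
      where
      open FanSubgraph m β σ
      A = chosenEdges
      unspanned = ¬spans⇒unspanned false σ β λ spanning → subst T spanning≡ spanning
      split = unspoked⇒unreached (proj₁ unspanned) (proj₁ (proj₂ unspanned)) (proj₁ (proj₂ (proj₂ unspanned)))
      2≤comps : 2 ≤ components (suc (suc m)) A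
      2≤comps = 2≤components A (suc m) (proj₁ split) (proj₁ (proj₂ split)) (proj₂ (proj₂ split))
      rankGap : rank (suc (suc m)) (fanEdges (suc m)) ∸ rank (suc (suc m)) A ≡ suc (suc m ∸ rank (suc (suc m)) A ∸ 1)
      rankGap = trans (cong (_∸ rank (suc (suc m)) A) (rank-fan m)) (sym (m+[n∸m]≡n {1} (m<n⇒0<n∸m (s≤s (∸-monoʳ-≤ (suc (suc m)) 2≤comps)))))

    columnSum : ℤ → ∀ m → Bool → Vec Bool m → ℤ
    columnSum y m s β = sumOver (λ σ → scanTerm y s σ β) (allBoolVecs (suc m))

    transfer : ℤ → ℕ → Bool → ℤ
    transfer y m s = sumOver (columnSum y m s) (allBoolVecs m)

    private
      factor : ℤ → Bool → Bool → ℤ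
      factor y s v = if s ∧ v then y ℤ.- + 1 else + 1

      indicator : Bool → ℤ
      indicator b = if b then + 1 else + 0

      ^-bit : ∀ x b e → x ^ (bit b + e) ≡ (if b then x else + 1) ℤ.* x ^ e
      ^-bit x true  e = refl
      ^-bit x false e = sym (ℤ.*-identityˡ _)

      scanTerm-joined : ∀ {m} y s v (σ : Vec Bool (suc m)) β → scanTerm y s (v ∷ σ) (true ∷ β) ≡ factor y s v ℤ.* scanTerm y (s ∨ v) σ β
      scanTerm-joined y s v σ β with spans (s ∨ v) σ β
      ... | true  = ^-bit (y ℤ.- + 1) (s ∧ v) (nullity (s ∨ v) σ β)
      ... | false = sym (ℤ.*-zeroʳ (factor y s v))

      scanTerm-cut : ∀ {m} y s v (σ : Vec Bool (suc m)) β →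
                     scanTerm y s (v ∷ σ) (false ∷ β) ≡ factor y s v ℤ.* (indicator (s ∨ v) ℤ.* scanTerm y false σ β)
      scanTerm-cut y s v σ β with s ∨ v | spans false σ β
      ... | false | _     = sym (ℤ.*-zeroʳ (factor y s v))
      ... | true  | true  = trans (^-bit (y ℤ.- + 1) (s ∧ v) (nullity false σ β)) (cong (factor y s v ℤ.*_) (sym (ℤ.*-identityˡ _)))
      ... | true  | false = sym (trans (cong (factor y s v ℤ.*_) (ℤ.*-zeroʳ (+ 1))) (ℤ.*-zeroʳ (factor y s v)))

      module Columns (y : ℤ) (m : ℕ) (β : Vec Bool m) where
        open ℤ-Solver
        W = allBoolVecs (suc m)
        St = columnSum y m true β
        Sf = columnSum y m false β

        firstSpoke : ∀ s b → columnSum y (suc m) s (b ∷ β) ≡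
          sumOver (λ σ → scanTerm y s (true ∷ σ) (b ∷ β)) W ℤ.+ sumOver (λ σ → scanTerm y s (false ∷ σ) (b ∷ β)) W
        firstSpoke s b = sumOver-allBoolVecs (suc m) (λ σ → scanTerm y s σ (b ∷ β))

        joined : ∀ s v → sumOver (λ σ → scanTerm y s (v ∷ σ) (true ∷ β)) W ≡ factor y s v ℤ.* columnSum y m (s ∨ v) β
        joined s v = trans (sumOver-cong W λ σ → scanTerm-joined y s v σ β) (sumOver-* (factor y s v) (λ σ → scanTerm y (s ∨ v) σ β) W)

        cut : ∀ s v → sumOver (λ σ → scanTerm y s (v ∷ σ) (false ∷ β)) W ≡ factor y s v ℤ.* (indicator (s ∨ v) ℤ.* Sf)
        cut s v = trans (sumOver-cong W λ σ → scanTerm-cut y s v σ β)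
          (trans (sumOver-* (factor y s v) (λ σ → indicator (s ∨ v) ℤ.* scanTerm y false σ β) W)
                 (cong (factor y s v ℤ.*_) (sumOver-* (indicator (s ∨ v)) (λ σ → scanTerm y false σ β) W)))

        open-joined : columnSum y (suc m) false (true ∷ β) ≡ St ℤ.+ Sf
        open-joined = trans (firstSpoke false true) (trans (cong₂ ℤ._+_ (joined false true) (joined false false))
          (solve 2 (λ a b → con (+ 1) :* a :+ con (+ 1) :* b := a :+ b) refl St Sf))

        open-cut : columnSum y (suc m) false (false ∷ β) ≡ Sf
        open-cut = trans (firstSpoke false false) (trans (cong₂ ℤ._+_ (cut false true) (cut false false))
          (solve 1 (λ b → con (+ 1) :* (con (+ 1) :* b) :+ con (+ 1) :* (con (+ 0) :* b) := b) refl Sf))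

        spoked-joined : columnSum y (suc m) true (true ∷ β) ≡ y ℤ.* St
        spoked-joined = trans (firstSpoke true true) (trans (cong₂ ℤ._+_ (joined true true) (joined true false))
          (solve 2 (λ y a → (y :- con (+ 1)) :* a :+ con (+ 1) :* a := y :* a) refl y St))

        spoked-cut : columnSum y (suc m) true (false ∷ β) ≡ y ℤ.* Sf
        spoked-cut = trans (firstSpoke true false) (trans (cong₂ ℤ._+_ (cut true true) (cut true false))
          (solve 2 (λ y b → (y :- con (+ 1)) :* (con (+ 1) :* b) :+ con (+ 1) :* (con (+ 1) :* b) := y :* b) refl y Sf))

    transfer-open : ∀ y m → transfer y (suc m) false ≡ (transfer y m true ℤ.+ transfer y m false) ℤ.+ transfer y m false
    transfer-open y m = trans (sumOver-allBoolVecs m (columnSum y (suc m) false)) (cong₂ ℤ._+_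
      (trans (sumOver-cong (allBoolVecs m) (Columns.open-joined y m)) (sumOver-+ (columnSum y m true) (columnSum y m false) (allBoolVecs m)))
      (sumOver-cong (allBoolVecs m) (Columns.open-cut y m)))

    transfer-spoked : ∀ y m → transfer y (suc m) true ≡ y ℤ.* transfer y m true ℤ.+ y ℤ.* transfer y m false
    transfer-spoked y m = trans (sumOver-allBoolVecs m (columnSum y (suc m) true)) (cong₂ ℤ._+_
      (trans (sumOver-cong (allBoolVecs m) (Columns.spoked-joined y m)) (sumOver-* y (columnSum y m true) (allBoolVecs m)))
      (trans (sumOver-cong (allBoolVecs m) (Columns.spoked-cut y m)) (sumOver-* y (columnSum y m false) (allBoolVecs m))))

    tutte≡transfer : ∀ m y → tutte (Fan (suc m)) (+ 1) y ≡ transfer y m false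
    tutte≡transfer m y = begin
      sumOver (summand m y) (subsets (fanEdges (suc m)))
        ≡⟨ cong (sumOver (summand m y) ∘ subsets) (fanEdges-applyUpTo (suc m)) ⟩
      sumOver (summand m y) (subsets (applyUpTo pathEdge m ++ applyUpTo spokeEdge (suc m)))
        ≡⟨ sumOver-subsets-++ (applyUpTo pathEdge m) (applyUpTo spokeEdge (suc m)) (summand m y) ⟩
      sumOver (λ B → sumOver (λ C → summand m y (B ++ C)) (subsets (applyUpTo spokeEdge (suc m)))) (subsets (applyUpTo pathEdge m))
        ≡⟨ sumOver-subsets-applyUpTo pathEdge m _ ⟩
      sumOver (λ β → sumOver (λ C → summand m y (select β pathEdge ++ C)) (subsets (applyUpTo spokeEdge (suc m)))) (allBoolVecs m)
        ≡⟨ sumOver-cong (allBoolVecs m) (λ β → sumOver-subsets-applyUpTo spokeEdge (suc m) _) ⟩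
      sumOver (λ β → sumOver (λ σ → summand m y (select β pathEdge ++ select σ spokeEdge)) (allBoolVecs (suc m))) (allBoolVecs m)
        ≡⟨ sumOver-cong (allBoolVecs m) (λ β → sumOver-cong (allBoolVecs (suc m)) (summand≡scanTerm m y β)) ⟩
      transfer y m false ∎
      where open ≡-Reasoning

  module Evaluation where

    open KimberlingNumbers
    open IntegerSums
    open TransferMatrix
    open ℤ-Solver

    mutual
      kimb-vanishes : ∀ n k → n ≤ k → kimb n k ≡ 0
      kimb-vanishes zero    k       _         = refl
      kimb-vanishes (suc n) (suc k) (s≤s n≤k) =
        cong₂ _+_ (kimb-vanishes n (suc k) (m≤n⇒m≤1+n n≤k)) (cong₂ _+_ (kimb-vanishes n k n≤k) (kimb₀-vanishes n (suc k) (m≤n⇒m≤1+n n≤k) z<s))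

      kimb₀-vanishes : ∀ n k → n ≤ k → 0 < k → kimb₀ n k ≡ 0
      kimb₀-vanishes zero    (suc k) _   _   = refl
      kimb₀-vanishes (suc n) k       n<k 0<k = cong₂ _+_ (kimb-vanishes n k (<⇒≤ n<k)) (kimb₀-vanishes n k (<⇒≤ n<k) 0<k)

    module _ (y : ℤ) where

      polySum-top : ∀ a D → a D ≡ 0 → polySum (suc D) a y ≡ polySum D a y
      polySum-top a D aD≡0 = begin
        sumOver term (upTo (suc D))                     ≡⟨ cong (sumOver term) (sym (upTo-∷ʳ D)) ⟩
        sumOver term (upTo D ++ D ∷ [])                 ≡⟨ sumOver-++ term (upTo D) (D ∷ []) ⟩
        sumOver term (upTo D) ℤ.+ (term D ℤ.+ + 0)      ≡⟨ cong (λ c → sumOver term (upTo D) ℤ.+ (+ c ℤ.* y ^ D ℤ.+ + 0)) aD≡0 ⟩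
        sumOver term (upTo D) ℤ.+ + 0                   ≡⟨ ℤ.+-identityʳ _ ⟩
        sumOver term (upTo D)                           ∎
        where
        open ≡-Reasoning
        term = λ k → + a k ℤ.* y ^ k

      polySum-+ : ∀ a b D → polySum D (λ k → a k + b k) y ≡ polySum D a y ℤ.+ polySum D b y
      polySum-+ a b D = trans (sumOver-cong (upTo D) λ k → ℤ.*-distribʳ-+ (y ^ k) (+ a k) (+ b k))
                              (sumOver-+ (λ k → + a k ℤ.* y ^ k) (λ k → + b k ℤ.* y ^ k) (upTo D))

      polySum-shift : ∀ a b D → b 0 ≡ 0 → (∀ k → b (suc k) ≡ a k) → polySum (suc D) b y ≡ y ℤ.* polySum D a y
      polySum-shift a b D b0≡0 b∘suc≡a = begin
        + b 0 ℤ.* + 1 ℤ.+ sumOver term (applyUpTo suc D) ≡⟨ cong (λ c → + c ℤ.* + 1 ℤ.+ sumOver term (applyUpTo suc D)) b0≡0 ⟩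
        + 0 ℤ.+ sumOver term (applyUpTo suc D)           ≡⟨ ℤ.+-identityˡ _ ⟩
        sumOver term (applyUpTo suc D)                   ≡⟨ cong sumℤ (trans (map-applyUpTo suc term D) (sym (map-upTo (term ∘ suc) D))) ⟩
        sumOver (term ∘ suc) (upTo D)                    ≡⟨ sumOver-cong (upTo D) shifted ⟩
        sumOver (λ k → y ℤ.* (+ a k ℤ.* y ^ k)) (upTo D) ≡⟨ sumOver-* y (λ k → + a k ℤ.* y ^ k) (upTo D) ⟩
        y ℤ.* polySum D a y                              ∎
        where
        open ≡-Reasoning
        term = λ k → + b k ℤ.* y ^ k
        shifted : ∀ k → term (suc k) ≡ y ℤ.* (+ a k ℤ.* y ^ k)
        shifted k = trans (cong (λ c → + c ℤ.* y ^ suc k) (b∘suc≡a k))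
                          (solve 3 (λ c y p → c :* (y :* p) := y :* (c :* p)) refl (+ a k) y (y ^ k))

      -- Generating polynomials of kimb (m + 1) and kimb₀ (m + 1), both of degree at most m.
      P Z : ℕ → ℤ
      P m = polySum (suc m) (kimb (suc m)) y
      Z m = polySum (suc m) (kimb₀ (suc m)) y

      P-step : ∀ m → P (suc m) ≡ P m ℤ.+ (y ℤ.* P m ℤ.+ Z m)
      P-step m = begin
        polySum (suc (suc m)) (kimb (suc (suc m))) y
          ≡⟨ polySum-+ (kimb (suc m)) (λ k → kimbShift (suc m) k + kimb₀ (suc m) k) (suc (suc m)) ⟩
        polySum (suc (suc m)) (kimb (suc m)) y ℤ.+ polySum (suc (suc m)) (λ k → kimbShift (suc m) k + kimb₀ (suc m) k) y
          ≡⟨ cong₂ ℤ._+_ (polySum-top (kimb (suc m)) (suc m) (kimb-vanishes (suc m) (suc m) ≤-refl))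
                         (polySum-+ (kimbShift (suc m)) (kimb₀ (suc m)) (suc (suc m))) ⟩
        P m ℤ.+ (polySum (suc (suc m)) (kimbShift (suc m)) y ℤ.+ polySum (suc (suc m)) (kimb₀ (suc m)) y)
          ≡⟨ cong (λ t → P m ℤ.+ t) (cong₂ ℤ._+_ (polySum-shift (kimb (suc m)) (kimbShift (suc m)) (suc m) refl (λ _ → refl))
                                          (polySum-top (kimb₀ (suc m)) (suc m) (kimb₀-vanishes (suc m) (suc m) ≤-refl z<s))) ⟩
        P m ℤ.+ (y ℤ.* P m ℤ.+ Z m) ∎
        where open ≡-Reasoning

      Z-step : ∀ m → Z (suc m) ≡ P m ℤ.+ Z m
      Z-step m = trans (polySum-+ (kimb (suc m)) (kimb₀ (suc m)) (suc (suc m)))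
        (cong₂ ℤ._+_ (polySum-top (kimb (suc m)) (suc m) (kimb-vanishes (suc m) (suc m) ≤-refl))
                     (polySum-top (kimb₀ (suc m)) (suc m) (kimb₀-vanishes (suc m) (suc m) ≤-refl z<s)))

      transfer-value : ∀ m → transfer y m false ≡ P m × transfer y m true ≡ (y ℤ.- + 1) ℤ.* P m ℤ.+ Z m
      transfer-value zero = refl , solve 1 (λ y → ((y :- con (+ 1)) :* con (+ 1) :+ (con (+ 1) :+ con (+ 0))) :+ con (+ 0)
                                                := (y :- con (+ 1)) :* (con (+ 1) :* con (+ 1) :+ con (+ 0)) :+ (con (+ 1) :* con (+ 1) :+ con (+ 0))) refl y
      transfer-value (suc m) = open′ , spoked′
        where
        open ≡-Reasoning
        IH = transfer-value m
        open′ : transfer y (suc m) false ≡ P (suc m)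
        open′ = begin
          transfer y (suc m) false ≡⟨ transfer-open y m ⟩
          (transfer y m true ℤ.+ transfer y m false) ℤ.+ transfer y m false ≡⟨ cong₂ (λ t f → (t ℤ.+ f) ℤ.+ f) (proj₂ IH) (proj₁ IH) ⟩
          ((y ℤ.- + 1) ℤ.* P m ℤ.+ Z m ℤ.+ P m) ℤ.+ P m
            ≡⟨ solve 3 (λ y p z → ((y :- con (+ 1)) :* p :+ z :+ p) :+ p := p :+ (y :* p :+ z)) refl y (P m) (Z m) ⟩
          P m ℤ.+ (y ℤ.* P m ℤ.+ Z m) ≡⟨ sym (P-step m) ⟩
          P (suc m) ∎
        spoked′ : transfer y (suc m) true ≡ (y ℤ.- + 1) ℤ.* P (suc m) ℤ.+ Z (suc m)
        spoked′ = begin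
          transfer y (suc m) true ≡⟨ transfer-spoked y m ⟩
          y ℤ.* transfer y m true ℤ.+ y ℤ.* transfer y m false ≡⟨ cong₂ (λ t f → y ℤ.* t ℤ.+ y ℤ.* f) (proj₂ IH) (proj₁ IH) ⟩
          y ℤ.* ((y ℤ.- + 1) ℤ.* P m ℤ.+ Z m) ℤ.+ y ℤ.* P m
            ≡⟨ solve 3 (λ y p z → y :* ((y :- con (+ 1)) :* p :+ z) :+ y :* p := (y :- con (+ 1)) :* (p :+ (y :* p :+ z)) :+ (p :+ z)) refl y (P m) (Z m) ⟩
          (y ℤ.- + 1) ℤ.* (P m ℤ.+ (y ℤ.* P m ℤ.+ Z m)) ℤ.+ (P m ℤ.+ Z m) ≡⟨ sym (cong₂ (λ p z → (y ℤ.- + 1) ℤ.* p ℤ.+ z) (P-step m) (Z-step m)) ⟩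
          (y ℤ.- + 1) ℤ.* P (suc m) ℤ.+ Z (suc m) ∎

    tutte-fan : ∀ m y → tutte (Fan (suc m)) (+ 1) y ≡ polySum (suc m) (kimb (suc m)) y
    tutte-fan m y = trans (tutte≡transfer m y) (proj₁ (transfer-value y m))

open import Data.Integer using (ℤ; +_)

theorem5p12 : (n : ℕ) → 1 ≤ n →
  Σ (ℕ → ℕ) (λ a →
    ((k : ℕ) → k < n →
      HasCard (RecurrentOfLevel n k) (a k) ×
      HasCard (IsSubgraphWithLastVertex n k) (a k) ×
      HasCard (KimbPath (n ∸ k) k) (a k)) ×
    ((x : ℤ) → tutte (Fan n) (+ 1) x ≡ polySum n a x))
theorem5p12 (suc m) _ = kimb (suc m) ,
  (λ k k<n → RecurrentCount.recurrentOfLevel-hasCard m k ,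
             SubgraphCount.subgraph-hasCard m k ,
             KimberlingCount.kimbPath-hasCard (suc m) k k<n) ,
  TuttePolynomial.Evaluation.tutte-fan m
  where open KimberlingNumbers using (kimb)
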